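{- Let $\mathbb{N}^{\mathrm{sf}}$ be the set of square-free integers $t\geq 2$, and let $U=\{t\in\mathbb{N}^{\mathrm{sf}} : t\equiv 1 \pmod 8\}$. Then the relative density $$\delta_{\mathrm{rel}}(U)=\lim_{X\to\infty}\frac{\#\{t\in U: t\leq X\}}{\#\{t\in\mathbb{N}^{\mathrm{sf}}: t\leq X\}}$$ exists and equals $\frac{1}{6}$. Moreover, for every $t\in U$, with $K=\mathbb{Q}(\sqrt{t})$: for all $a,b\in\mathcal{O}_K\setminus\{0\}$ and $c=2^d b-3^r$ with $r,d$ positive integers, $d\geq 2$ and $r$ odd, the equation $ax^d-y^2-z^2+xyz-c=0$ has no solution $(x_0,y_0,z_0)\in\mathcal{O}_K^3$ with $x_0\in 2\mathcal{O}_K$. -}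

module Defs where

open import Data.Bool using (Bool; true; false; not; T)
open import Data.Nat as ℕ using (ℕ; zero; suc; _∸_; _≤_; _%_)
open import Data.Nat.Divisibility using (_∣?_)
open import Data.Integer as ℤ using (ℤ; +_)
open import Data.Rational as ℚ using (ℚ; 0ℚ; 1ℚ; _<_)
open import Data.List using (List; []; _∷_; upTo; map; length; filterᵇ)
open import Data.Bool.ListAction using (any)
open import Data.Product using (_×_; _,_; Σ; ∃; ∃-syntax; proj₁; proj₂)
open import Relation.Nullary.Decidable using (⌊_⌋)
open import Relation.Binary.PropositionalEquality using (_≡_)

-- Square-free natural numbers:  n is square-free iff no d ≥ 2 has d² ∣ n.
-- (For n ≥ 1 any such d satisfies d ≤ n, so checking 2 ≤ d ≤ n suffices.)

squareFreeᵇ : ℕ → Bool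
squareFreeᵇ n = not (any (λ d → ⌊ (d ℕ.* d) ∣? n ⌋) (map (2 ℕ.+_) (upTo (n ∸ 1))))

SquareFree : ℕ → Set
SquareFree n = T (squareFreeᵇ n)

inNsfᵇ : ℕ → Bool
inNsfᵇ t = (2 ℕ.≤ᵇ t) Data.Bool.∧ squareFreeᵇ t

inUᵇ : ℕ → Bool
inUᵇ t = inNsfᵇ t Data.Bool.∧ ((t % 8) ℕ.≡ᵇ 1)

InU : ℕ → Set
InU t = (2 ≤ t) × SquareFree t × (t % 8 ≡ 1)

countUpTo : (ℕ → Bool) → ℕ → ℕ
countUpTo P X = length (filterᵇ P (upTo (suc X)))

-- the ratio #{t ∈ U : t ≤ X} / #{t ∈ N^sf : t ≤ X}  (set to 0 when the
-- denominator vanishes, i.e. for X < 2; irrelevant for the limit)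
ratio : ℕ → ℚ
ratio X with countUpTo inNsfᵇ X
... | zero  = 0ℚ
... | suc k = (+ countUpTo inUᵇ X) ℚ./ suc k

Converges : (ℕ → ℚ) → ℚ → Set
Converges f q = ∀ (ε : ℚ) → 0ℚ < ε →
  ∃[ N ] (∀ X → N ≤ X → ℚ.∣ f X ℚ.- q ∣ < ε)

-- The quadratic field K = Q(√t): elements p + q√t represented as (p , q).

K : Set
K = ℚ × ℚ

module _ (t : ℕ) where
  tℚ : ℚ
  tℚ = (+ t) ℚ./ 1

  _+K_ : K → K → K
  (p , q) +K (r , s) = (p ℚ.+ r , q ℚ.+ s)

  _-K_ : K → K → K
  (p , q) -K (r , s) = (p ℚ.- r , q ℚ.- s)

  _*K_ : K → K → K
  (p , q) *K (r , s) = (p ℚ.* r ℚ.+ tℚ ℚ.* (q ℚ.* s) , p ℚ.* s ℚ.+ q ℚ.* r)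

  0K : K
  0K = (0ℚ , 0ℚ)

  1K : K
  1K = (1ℚ , 0ℚ)

  fromℤK : ℤ → K
  fromℤK z = (z ℚ./ 1 , 0ℚ)

  _^K_ : K → ℕ → K
  x ^K zero = 1K
  x ^K suc n = x *K (x ^K n)

  -- value at x of the monic polynomial X^n + c_{n-1} X^{n-1} + … + c₀
  -- where cs = c₀ ∷ c₁ ∷ … ∷ c_{n-1}  (Horner scheme)
  evalMonic : List ℤ → K → K
  evalMonic []       x = 1K
  evalMonic (c ∷ cs) x = fromℤK c +K (x *K evalMonic cs x)

  -- x is an algebraic integer: root of a monic polynomial with integer
  -- coefficients.  O_K = { x ∈ K : IsIntegral x }.
  IsIntegral : K → Set
  IsIntegral x = ∃[ cs ] (evalMonic cs x ≡ 0K)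

  In2OK : K → Set
  In2OK x = ∃[ w ] (IsIntegral w × x ≡ fromℤK (+ 2) *K w)

  infixl 6 _+K_ _-K_
  infixl 7 _*K_
  infixr 8 _^K_

  cval : K → ℕ → ℕ → K
  cval b d r = (fromℤK (+ 2) ^K d) *K b -K (fromℤK (+ 3) ^K r)

  lhs : K → K → ℕ → ℕ → K → K → K → K
  lhs a b d r x y z =
    ((((a *K (x ^K d)) -K (y *K y)) -K (z *K z)) +K (x *K (y *K z))) -K cval b d r

Odd : ℕ → Set
Odd r = ∃[ k ] (r ≡ suc (2 ℕ.* k))

{-# OPTIONS --safe #-}
module Submission where

-- Up to X, U consists of the m ≡ 1 (mod 8) free of odd square divisors, and N of the
-- m ≥ 2 free of the divisor 4 and of odd square divisors. Keeping only the odd squares d² with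
-- d ≤ 2K + 1 gives conditions periodic modulo 8M, M = ∏ d² ≡ 1 (mod 8). Shifting by multiples of
-- M preserves the sieve and permutes the residue classes mod 8, so all eight classes have the same
-- count per period and the numbers not divisible by 4 fill six of them: the sieved counts satisfy
-- 6U′ ≈ N′ up to O(M). The sieve errs only on numbers with a square divisor d² with d ≥ 2K + 3,
-- at most Σ X/d² ≤ X/(2K + 2) of them, while N ≥ X/4 − 1; letting K grow gives U/N → 1/6.
--
-- For t = 8u + 1 the prime 2 splits in ℚ(√t): s = 4u − 1 satisfies s² ≡ t (mod 16),
-- and p + q√t ↦ p ± qs are ring homomorphisms from ℤ₍₂₎[(1 + √t)/2] to ℤ₍₂₎/4. Every algebraic
-- integer of ℚ(√t) lies in that ring: if 2μx does, both images of 2μx must be even (an odd image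
-- would make the image of the rescaled monic equation odd rather than 0), hence μx does too,
-- and denominators are removed one factor 2 at a time. Reducing the equation with x = 2w, d ≥ 2,
-- 2^d ≡ 0 and 3^r ≡ 3 (mod 4) leaves y² + z² − 2wyz ≡ 3 (mod 4) in ℤ₍₂₎, which fails for each
-- parity of y and z.

module Parity where

  open import Data.Nat using (zero; suc; _+_; _*_)
  open import Data.Nat.Properties using (+-suc)
  open import Data.Product using (_,_; ∃-syntax)
  open import Data.Sum using (_⊎_; inj₁; inj₂)
  open import Relation.Binary.PropositionalEquality using (_≡_; refl; cong; sym)

  ℕ-parity : ∀ n → (∃[ k ] n ≡ 2 * k) ⊎ (∃[ k ] n ≡ suc (2 * k))
  ℕ-parity zero = inj₁ (0 , refl)
  ℕ-parity (suc n) with ℕ-parity n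
  ... | inj₁ (k , refl) = inj₂ (k , refl)
  ... | inj₂ (k , refl) = inj₁ (suc k , cong suc (sym (+-suc k (k + 0))))

module LocalisationAtTwo where

  open import Data.Nat as ℕ using (ℕ; zero; suc)
  import Data.Nat.Properties as ℕ
  import Data.Nat.Solver as ℕ-Solver
  open import Data.Integer as ℤ using (ℤ; +_; -[1+_])
  import Data.Integer.Properties as ℤ
  import Data.Integer.DivMod as ℤ
  import Data.Integer.Solver as ℤ-Solver
  open import Data.Rational as ℚ using (ℚ; _+_; _*_; _-_; -_; 0ℚ; 1ℚ; toℚᵘ; _/_)
  import Data.Rational.Properties as ℚ
  open import Data.Rational.Unnormalised as ℚᵘ using (mkℚᵘ; *≡*)
  import Data.Rational.Unnormalised.Properties as ℚᵘ
  open import Data.Rational.Solver using (module +-*-Solver)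
  open import Data.Sum using (_⊎_; inj₁; inj₂)
  open import Data.Empty using (⊥)
  open import Relation.Nullary using (¬_)
  open import Relation.Binary.Bundles using (Setoid)
  open import Relation.Binary.PropositionalEquality
  open +-*-Solver

  ι : ℤ → ℚ
  ι n = n / 1

  private
    toℚᵘ-ι : ∀ n → toℚᵘ (ι n) ℚᵘ.≃ mkℚᵘ n 0
    toℚᵘ-ι n = ℚ.toℚᵘ-fromℚᵘ (mkℚᵘ n 0)

    module ℤS = ℤ-Solver.+-*-Solver

  ι-+ : ∀ a b → ι (a ℤ.+ b) ≡ ι a + ι b
  ι-+ a b = ℚ.toℚᵘ-injective (begin
    toℚᵘ (ι (a ℤ.+ b))           ≈⟨ toℚᵘ-ι (a ℤ.+ b) ⟩
    mkℚᵘ (a ℤ.+ b) 0             ≈⟨ *≡* (cong (ℤ._* + 1) (sym (cong₂ ℤ._+_ (ℤ.*-identityʳ a) (ℤ.*-identityʳ b)))) ⟩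
    mkℚᵘ a 0 ℚᵘ.+ mkℚᵘ b 0       ≈⟨ ℚᵘ.+-cong (ℚᵘ.≃-sym (toℚᵘ-ι a)) (ℚᵘ.≃-sym (toℚᵘ-ι b)) ⟩
    toℚᵘ (ι a) ℚᵘ.+ toℚᵘ (ι b)   ≈⟨ ℚᵘ.≃-sym (ℚ.toℚᵘ-homo-+ (ι a) (ι b)) ⟩
    toℚᵘ (ι a + ι b)             ∎)
    where open ℚᵘ.≃-Reasoning

  ι-* : ∀ a b → ι (a ℤ.* b) ≡ ι a * ι b
  ι-* a b = ℚ.toℚᵘ-injective (begin
    toℚᵘ (ι (a ℤ.* b))           ≈⟨ toℚᵘ-ι (a ℤ.* b) ⟩
    mkℚᵘ (a ℤ.* b) 0             ≈⟨ ℚᵘ.*-cong (ℚᵘ.≃-sym (toℚᵘ-ι a)) (ℚᵘ.≃-sym (toℚᵘ-ι b)) ⟩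
    toℚᵘ (ι a) ℚᵘ.* toℚᵘ (ι b)   ≈⟨ ℚᵘ.≃-sym (ℚ.toℚᵘ-homo-* (ι a) (ι b)) ⟩
    toℚᵘ (ι a * ι b)             ∎)
    where open ℚᵘ.≃-Reasoning

  ι-neg : ∀ a → ι (ℤ.- a) ≡ - ι a
  ι-neg a = ℚ.toℚᵘ-injective (begin
    toℚᵘ (ι (ℤ.- a))    ≈⟨ toℚᵘ-ι (ℤ.- a) ⟩
    ℚᵘ.- mkℚᵘ a 0       ≈⟨ ℚᵘ.-‿cong (ℚᵘ.≃-sym (toℚᵘ-ι a)) ⟩
    ℚᵘ.- toℚᵘ (ι a)     ≈⟨ ℚᵘ.≃-sym (ℚ.toℚᵘ-homo‿- (ι a)) ⟩
    toℚᵘ (- ι a)        ∎)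
    where open ℚᵘ.≃-Reasoning

  ι-- : ∀ a b → ι (a ℤ.- b) ≡ ι a - ι b
  ι-- a b = trans (ι-+ a (ℤ.- b)) (cong (λ x → ι a + x) (ι-neg b))

  ι-injective : ∀ {a b} → ι a ≡ ι b → a ≡ b
  ι-injective {a} {b} e with ℚᵘ.≃-trans (ℚᵘ.≃-sym (toℚᵘ-ι a)) (ℚᵘ.≃-trans (ℚ.toℚᵘ-cong e) (toℚᵘ-ι b))
  ... | *≡* eq = trans (sym (ℤ.*-identityʳ a)) (trans eq (ℤ.*-identityʳ b))

  p*↧p≡↥p : ∀ p → p * ι (+ ℚ.↧ₙ p) ≡ ι (ℚ.↥ p)
  p*↧p≡↥p p@(ℚ.mkℚ n d-1 _) = ℚ.toℚᵘ-injective (begin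
    toℚᵘ (p * ι d)             ≈⟨ ℚ.toℚᵘ-homo-* p (ι d) ⟩
    toℚᵘ p ℚᵘ.* toℚᵘ (ι d)     ≈⟨ ℚᵘ.*-congˡ {toℚᵘ p} (toℚᵘ-ι d) ⟩
    mkℚᵘ n d-1 ℚᵘ.* mkℚᵘ d 0   ≈⟨ *≡* (ℤ.*-assoc n d (+ 1)) ⟩
    mkℚᵘ n 0                   ≈⟨ ℚᵘ.≃-sym (toℚᵘ-ι n) ⟩
    toℚᵘ (ι n)                 ∎)
    where
    open ℚᵘ.≃-Reasoning
    d : ℤ
    d = + suc d-1

  two four half : ℚ
  two = ι (+ 2)
  four = two * two
  half = + 1 / 2

  odd : ℕ → ℚ
  odd k = ι (+ suc (2 ℕ.* k))

  odd-* : ∀ j k → odd j * odd k ≡ odd (j ℕ.+ k ℕ.+ 2 ℕ.* (j ℕ.* k))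
  odd-* j k = trans (sym (ι-* (+ suc (2 ℕ.* j)) (+ suc (2 ℕ.* k))))
    (cong (λ n → ι (+ n)) (ℕS.solve 2 (λ j k → (ℕS.con 1 ℕS.:+ ℕS.con 2 ℕS.:* j) ℕS.:* (ℕS.con 1 ℕS.:+ ℕS.con 2 ℕS.:* k)
                         ℕS.:= ℕS.con 1 ℕS.:+ ℕS.con 2 ℕS.:* (j ℕS.:+ k ℕS.:+ ℕS.con 2 ℕS.:* (j ℕS.:* k))) refl j k))
    where module ℕS = ℕ-Solver.+-*-Solver

  record ℤ₍₂₎ (α : ℚ) : Set where
    constructor cleared
    field
      oddFactor : ℕ
      numerator : ℤ
      α*odd≡ι : α * odd oddFactor ≡ ι numerator

  private
    variable
      α β γ δ m n : ℚ

  ℤ₍₂₎-ι : ∀ n → ℤ₍₂₎ (ι n)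
  ℤ₍₂₎-ι n = cleared 0 n (ℚ.*-identityʳ (ι n))

  ℤ₍₂₎-0 : ℤ₍₂₎ 0ℚ
  ℤ₍₂₎-0 = ℤ₍₂₎-ι (+ 0)

  ℤ₍₂₎-1 : ℤ₍₂₎ 1ℚ
  ℤ₍₂₎-1 = ℤ₍₂₎-ι (+ 1)

  ℤ₍₂₎-2 : ℤ₍₂₎ two
  ℤ₍₂₎-2 = ℤ₍₂₎-ι (+ 2)

  ℤ₍₂₎-+ : ℤ₍₂₎ α → ℤ₍₂₎ β → ℤ₍₂₎ (α + β)
  ℤ₍₂₎-+ {α} {β} (cleared j a eα) (cleared k b eβ) = cleared (j ℕ.+ k ℕ.+ 2 ℕ.* (j ℕ.* k)) (a ℤ.* ok ℤ.+ b ℤ.* oj) (begin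
    (α + β) * odd (j ℕ.+ k ℕ.+ 2 ℕ.* (j ℕ.* k)) ≡⟨ cong ((α + β) *_) (sym (odd-* j k)) ⟩
    (α + β) * (odd j * odd k)                   ≡⟨ solve 4 (λ α β x y → (α :+ β) :* (x :* y) := (α :* x) :* y :+ (β :* y) :* x) refl α β (odd j) (odd k) ⟩
    (α * odd j) * odd k + (β * odd k) * odd j   ≡⟨ cong₂ (λ u v → u * odd k + v * odd j) eα eβ ⟩
    ι a * ι ok + ι b * ι oj                     ≡⟨ sym (cong₂ _+_ (ι-* a ok) (ι-* b oj)) ⟩
    ι (a ℤ.* ok) + ι (b ℤ.* oj)                 ≡⟨ sym (ι-+ (a ℤ.* ok) (b ℤ.* oj)) ⟩
    ι (a ℤ.* ok ℤ.+ b ℤ.* oj)                   ∎)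
    where
    open ≡-Reasoning
    oj ok : ℤ
    oj = + suc (2 ℕ.* j)
    ok = + suc (2 ℕ.* k)

  ℤ₍₂₎-* : ℤ₍₂₎ α → ℤ₍₂₎ β → ℤ₍₂₎ (α * β)
  ℤ₍₂₎-* {α} {β} (cleared j a eα) (cleared k b eβ) = cleared (j ℕ.+ k ℕ.+ 2 ℕ.* (j ℕ.* k)) (a ℤ.* b) (begin
    (α * β) * odd (j ℕ.+ k ℕ.+ 2 ℕ.* (j ℕ.* k)) ≡⟨ cong ((α * β) *_) (sym (odd-* j k)) ⟩
    (α * β) * (odd j * odd k)                   ≡⟨ solve 4 (λ α β x y → (α :* β) :* (x :* y) := (α :* x) :* (β :* y)) refl α β (odd j) (odd k) ⟩
    (α * odd j) * (β * odd k)                   ≡⟨ cong₂ _*_ eα eβ ⟩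
    ι a * ι b                                   ≡⟨ sym (ι-* a b) ⟩
    ι (a ℤ.* b)                                 ∎)
    where open ≡-Reasoning

  ℤ₍₂₎-neg : ℤ₍₂₎ α → ℤ₍₂₎ (- α)
  ℤ₍₂₎-neg {α} (cleared k a e) = cleared k (ℤ.- a) (begin
    (- α) * odd k   ≡⟨ solve 2 (λ α x → (:- α) :* x := :- (α :* x)) refl α (odd k) ⟩
    - (α * odd k)   ≡⟨ cong -_ e ⟩
    - ι a           ≡⟨ sym (ι-neg a) ⟩
    ι (ℤ.- a)       ∎)
    where open ≡-Reasoning

  ℤ₍₂₎-- : ℤ₍₂₎ α → ℤ₍₂₎ β → ℤ₍₂₎ (α - β)
  ℤ₍₂₎-- a b = ℤ₍₂₎-+ a (ℤ₍₂₎-neg b)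

  ℤ₍₂₎-cancel-odd : ∀ j → ℤ₍₂₎ (α * odd j) → ℤ₍₂₎ α
  ℤ₍₂₎-cancel-odd {α} j (cleared k a e) = cleared (j ℕ.+ k ℕ.+ 2 ℕ.* (j ℕ.* k)) a (begin
    α * odd (j ℕ.+ k ℕ.+ 2 ℕ.* (j ℕ.* k)) ≡⟨ cong (α *_) (sym (odd-* j k)) ⟩
    α * (odd j * odd k)                   ≡⟨ sym (ℚ.*-assoc α (odd j) (odd k)) ⟩
    α * odd j * odd k                     ≡⟨ e ⟩
    ι a                                   ∎)
    where open ≡-Reasoning

  infix 4 _≈_mod_

  record _≈_mod_ (α β m : ℚ) : Set where
    constructor ≈-by
    field
      quotient : ℚ
      quotient∈ℤ₍₂₎ : ℤ₍₂₎ quotient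
      α-β≡m*quotient : α - β ≡ m * quotient

  ≈-reflexive : α ≡ β → α ≈ β mod m
  ≈-reflexive {α} {m = m} refl = ≈-by 0ℚ ℤ₍₂₎-0 (solve 2 (λ α m → α :- α := m :* con 0ℚ) refl α m)

  ≈-refl : α ≈ α mod m
  ≈-refl = ≈-reflexive refl

  ≈-sym : α ≈ β mod m → β ≈ α mod m
  ≈-sym {α} {β} {m} (≈-by q q∈ e) = ≈-by (- q) (ℤ₍₂₎-neg q∈) (begin
    β - α       ≡⟨ solve 2 (λ α β → β :- α := :- (α :- β)) refl α β ⟩
    - (α - β)   ≡⟨ cong -_ e ⟩
    - (m * q)   ≡⟨ solve 2 (λ m q → :- (m :* q) := m :* (:- q)) refl m q ⟩
    m * - q     ∎)
    where open ≡-Reasoning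

  ≈-trans : α ≈ β mod m → β ≈ γ mod m → α ≈ γ mod m
  ≈-trans {α} {β} {m} {γ} (≈-by q q∈ e) (≈-by r r∈ f) = ≈-by (q + r) (ℤ₍₂₎-+ q∈ r∈) (begin
    α - γ               ≡⟨ solve 3 (λ α β γ → α :- γ := (α :- β) :+ (β :- γ)) refl α β γ ⟩
    (α - β) + (β - γ)   ≡⟨ cong₂ _+_ e f ⟩
    m * q + m * r       ≡⟨ sym (ℚ.*-distribˡ-+ m q r) ⟩
    m * (q + r)         ∎)
    where open ≡-Reasoning

  ≈-setoid : ℚ → Setoid _ _
  ≈-setoid m = record
    { Carrier = ℚ
    ; _≈_ = λ x y → x ≈ y mod m
    ; isEquivalence = record { refl = ≈-refl ; sym = ≈-sym ; trans = ≈-trans }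
    }

  module ≈-Reasoning (m : ℚ) where
    open import Relation.Binary.Reasoning.Setoid (≈-setoid m) public

  ≈-+ : α ≈ β mod m → γ ≈ δ mod m → α + γ ≈ β + δ mod m
  ≈-+ {α} {β} {m} {γ} {δ} (≈-by q q∈ e) (≈-by r r∈ f) = ≈-by (q + r) (ℤ₍₂₎-+ q∈ r∈) (begin
    (α + γ) - (β + δ)   ≡⟨ solve 4 (λ α β γ δ → (α :+ γ) :- (β :+ δ) := (α :- β) :+ (γ :- δ)) refl α β γ δ ⟩
    (α - β) + (γ - δ)   ≡⟨ cong₂ _+_ e f ⟩
    m * q + m * r       ≡⟨ sym (ℚ.*-distribˡ-+ m q r) ⟩
    m * (q + r)         ∎)
    where open ≡-Reasoning

  ≈-neg : α ≈ β mod m → - α ≈ - β mod m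
  ≈-neg {α} {β} {m} (≈-by q q∈ e) = ≈-by (- q) (ℤ₍₂₎-neg q∈) (begin
    - α - - β   ≡⟨ solve 2 (λ α β → :- α :- :- β := :- (α :- β)) refl α β ⟩
    - (α - β)   ≡⟨ cong -_ e ⟩
    - (m * q)   ≡⟨ solve 2 (λ m q → :- (m :* q) := m :* (:- q)) refl m q ⟩
    m * - q     ∎)
    where open ≡-Reasoning

  ≈-- : α ≈ β mod m → γ ≈ δ mod m → α - γ ≈ β - δ mod m
  ≈-- p q = ≈-+ p (≈-neg q)

  ≈-*ˡ : ℤ₍₂₎ γ → α ≈ β mod m → γ * α ≈ γ * β mod m
  ≈-*ˡ {γ} {α} {β} {m} γ∈ (≈-by q q∈ e) = ≈-by (γ * q) (ℤ₍₂₎-* γ∈ q∈) (begin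
    γ * α - γ * β   ≡⟨ solve 3 (λ γ α β → γ :* α :- γ :* β := γ :* (α :- β)) refl γ α β ⟩
    γ * (α - β)     ≡⟨ cong (γ *_) e ⟩
    γ * (m * q)     ≡⟨ solve 3 (λ γ m q → γ :* (m :* q) := m :* (γ :* q)) refl γ m q ⟩
    m * (γ * q)     ∎)
    where open ≡-Reasoning

  ≈-*ʳ : ℤ₍₂₎ γ → α ≈ β mod m → α * γ ≈ β * γ mod m
  ≈-*ʳ {γ} {α} {β} γ∈ p = subst₂ (λ x y → x ≈ y mod _) (ℚ.*-comm γ α) (ℚ.*-comm γ β) (≈-*ˡ γ∈ p)

  ≈-* : ℤ₍₂₎ β → ℤ₍₂₎ γ → α ≈ β mod m → γ ≈ δ mod m → α * γ ≈ β * δ mod m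
  ≈-* β∈ γ∈ p q = ≈-trans (≈-*ʳ γ∈ p) (≈-*ˡ β∈ q)

  ≈-scale : ∀ c → α ≈ β mod m → c * α ≈ c * β mod (c * m)
  ≈-scale {α} {β} {m} c (≈-by q q∈ e) = ≈-by q q∈ (begin
    c * α - c * β   ≡⟨ solve 3 (λ c α β → c :* α :- c :* β := c :* (α :- β)) refl c α β ⟩
    c * (α - β)     ≡⟨ cong (c *_) e ⟩
    c * (m * q)     ≡⟨ sym (ℚ.*-assoc c m q) ⟩
    c * m * q       ∎)
    where open ≡-Reasoning

  ≈-weaken : ℤ₍₂₎ n → α ≈ β mod (m * n) → α ≈ β mod m
  ≈-weaken {n} {α} {β} {m} n∈ (≈-by q q∈ e) = ≈-by (n * q) (ℤ₍₂₎-* n∈ q∈) (trans e (ℚ.*-assoc m n q))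

  ≈-ℤ₍₂₎ : ℤ₍₂₎ m → ℤ₍₂₎ β → α ≈ β mod m → ℤ₍₂₎ α
  ≈-ℤ₍₂₎ {m} {β} {α} m∈ β∈ (≈-by q q∈ e) =
    subst ℤ₍₂₎ (trans (cong (λ x → β + x) (sym e)) (solve 2 (λ α β → β :+ (α :- β) := α) refl α β)) (ℤ₍₂₎-+ β∈ (ℤ₍₂₎-* m∈ q∈))

  ≈0-* : α ≈ 0ℚ mod m → β ≈ 0ℚ mod n → α * β ≈ 0ℚ mod (m * n)
  ≈0-* {α} {m} {β} {n} (≈-by q q∈ e) (≈-by r r∈ f) = ≈-by (q * r) (ℤ₍₂₎-* q∈ r∈) (begin
    α * β - 0ℚ                  ≡⟨ solve 2 (λ α β → α :* β :- con 0ℚ := (α :- con 0ℚ) :* (β :- con 0ℚ)) refl α β ⟩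
    (α - 0ℚ) * (β - 0ℚ)         ≡⟨ cong₂ _*_ e f ⟩
    (m * q) * (n * r)           ≡⟨ solve 4 (λ m q n r → (m :* q) :* (n :* r) := (m :* n) :* (q :* r)) refl m q n r ⟩
    (m * n) * (q * r)           ∎)
    where open ≡-Reasoning

  ≈-square : ℤ₍₂₎ β → α ≈ β mod two → α * α ≈ β * β mod four
  ≈-square {β} {α} β∈ (≈-by q q∈ e) = ≈-by (q * (β + q)) (ℤ₍₂₎-* q∈ (ℤ₍₂₎-+ β∈ q∈)) (begin
    α * α - β * β                             ≡⟨ solve 2 (λ α β → α :* α :- β :* β := (α :- β) :* (con two :* β :+ (α :- β))) refl α β ⟩
    (α - β) * (two * β + (α - β))             ≡⟨ cong (λ d → d * (two * β + d)) e ⟩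
    two * q * (two * β + two * q)             ≡⟨ solve 2 (λ β q → con two :* q :* (con two :* β :+ con two :* q) := con four :* (q :* (β :+ q))) refl β q ⟩
    four * (q * (β + q))                      ∎)
    where open ≡-Reasoning

  ≈0⇒≈ : α - β ≈ 0ℚ mod m → α ≈ β mod m
  ≈0⇒≈ {α} {β} (≈-by q q∈ e) = ≈-by q q∈ (trans (sym (ℚ.+-identityʳ (α - β))) e)

  ≈0-of-even-numerator : ∀ k m → α * odd k ≡ ι (m ℤ.* + 2) → α ≈ 0ℚ mod two
  ≈0-of-even-numerator {α} k m e = ≈-by (α * half) (cleared k m (begin
    α * half * odd k        ≡⟨ solve 3 (λ α h o → α :* h :* o := α :* o :* h) refl α half (odd k) ⟩
    α * odd k * half        ≡⟨ cong (_* half) (trans e (ι-* m (+ 2))) ⟩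
    ι m * two * half        ≡⟨ solve 1 (λ x → x :* con two :* con half := x) refl (ι m) ⟩
    ι m                     ∎)) (solve 1 (λ α → α :- con 0ℚ := con two :* (α :* con half)) refl α)
    where open ≡-Reasoning

  parity : ℤ₍₂₎ α → α ≈ 0ℚ mod two ⊎ α ≈ 1ℚ mod two
  parity {α} (cleared k n e) with n ℤ.%ℕ 2 | ℤ.n%ℕd<d n 2 | ℤ.a≡a%ℕn+[a/ℕn]*n n 2
  ... | 0 | _ | n≡ = inj₁ (≈0-of-even-numerator k (n ℤ./ℕ 2) (trans e (cong ι (trans n≡ (ℤ.+-identityˡ (n ℤ./ℕ 2 ℤ.* + 2))))))
  ... | 1 | _ | n≡ = inj₂ (≈0⇒≈ (≈0-of-even-numerator {α - 1ℚ} k (h ℤ.- + k) (begin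
    (α - 1ℚ) * odd k                          ≡⟨ solve 2 (λ α o → (α :- con 1ℚ) :* o := α :* o :- o) refl α (odd k) ⟩
    α * odd k - odd k                         ≡⟨ cong (_- odd k) (trans e (cong ι n≡)) ⟩
    ι (+ 1 ℤ.+ h ℤ.* + 2) - odd k             ≡⟨ sym (ι-- (+ 1 ℤ.+ h ℤ.* + 2) (+ suc (2 ℕ.* k))) ⟩
    ι (+ 1 ℤ.+ h ℤ.* + 2 ℤ.- + suc (2 ℕ.* k)) ≡⟨ cong ι (even-difference h k) ⟩
    ι ((h ℤ.- + k) ℤ.* + 2)                   ∎)))
    where
    open ≡-Reasoning
    h : ℤ
    h = n ℤ./ℕ 2
    even-difference : ∀ h k → + 1 ℤ.+ h ℤ.* + 2 ℤ.- + suc (2 ℕ.* k) ≡ (h ℤ.- + k) ℤ.* + 2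
    even-difference h k = trans (cong (λ x → + 1 ℤ.+ h ℤ.* + 2 ℤ.- (+ 1 ℤ.+ x)) (ℤ.pos-* 2 k))
      (ℤS.solve 2 (λ h k → ℤS.con (+ 1) ℤS.:+ h ℤS.:* ℤS.con (+ 2) ℤS.:- (ℤS.con (+ 1) ℤS.:+ ℤS.con (+ 2) ℤS.:* k)
                        ℤS.:= (h ℤS.:- k) ℤS.:* ℤS.con (+ 2)) refl h (+ k))
  ... | suc (suc _) | ℕ.s≤s (ℕ.s≤s ()) | _

  odd≉0 : ∀ k → ¬ (odd k ≈ 0ℚ mod two)
  odd≉0 j (≈-by q (cleared k n e) f) = odd≢even {j ℕ.+ k ℕ.+ 2 ℕ.* (j ℕ.* k)} n (ι-injective (begin
    ι (+ suc (2 ℕ.* (j ℕ.+ k ℕ.+ 2 ℕ.* (j ℕ.* k)))) ≡⟨ sym (odd-* j k) ⟩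
    odd j * odd k                    ≡⟨ cong (_* odd k) (trans (sym (ℚ.+-identityʳ (odd j))) f) ⟩
    two * q * odd k                  ≡⟨ ℚ.*-assoc two q (odd k) ⟩
    two * (q * odd k)                ≡⟨ cong (two *_) e ⟩
    two * ι n                        ≡⟨ sym (ι-* (+ 2) n) ⟩
    ι (+ 2 ℤ.* n)                    ∎))
    where
    open ≡-Reasoning
    odd≢even : ∀ {i} n → + suc (2 ℕ.* i) ≢ + 2 ℤ.* n
    odd≢even {i} (+ n) eq = ℕ.even≢odd n i (sym (ℤ.+-injective (trans eq (sym (ℤ.pos-* 2 n)))))
    odd≢even -[1+ n ] ()

  ≈0⇒half∈ℤ₍₂₎ : α ≈ 0ℚ mod two → ℤ₍₂₎ (half * α)
  ≈0⇒half∈ℤ₍₂₎ {α} (≈-by q q∈ e) = subst ℤ₍₂₎ (begin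
    q                      ≡⟨ solve 1 (λ q → q := con half :* (con two :* q)) refl q ⟩
    half * (two * q)       ≡⟨ cong (half *_) (sym e) ⟩
    half * (α - 0ℚ)        ≡⟨ cong (half *_) (ℚ.+-identityʳ α) ⟩
    half * α               ∎) q∈
    where open ≡-Reasoning

  two≉0 : ¬ (two ≈ 0ℚ mod four)
  two≉0 (≈-by q q∈ e) = odd≉0 0 (≈-by q q∈ (begin
    1ℚ - 0ℚ             ≡⟨ solve 0 (con 1ℚ :- con 0ℚ := con half :* (con two :- con 0ℚ)) refl ⟩
    half * (two - 0ℚ)   ≡⟨ cong (half *_) e ⟩
    half * (four * q)   ≡⟨ solve 1 (λ q → con half :* (con four :* q) := con two :* q) refl q ⟩
    two * q             ∎))
    where open ≡-Reasoning

  two*≈0 : ℤ₍₂₎ α → two * α ≈ 0ℚ mod two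
  two*≈0 {α} α∈ = ≈-by α α∈ (ℚ.+-identityʳ (two * α))

  ι9^≈1 : ∀ k → ι ((+ 9) ℤ.^ k) ≈ 1ℚ mod four
  ι9^≈1 zero = ≈-refl
  ι9^≈1 (suc k) = begin
    ι ((+ 9) ℤ.^ suc k)          ≡⟨ ι-* (+ 9) ((+ 9) ℤ.^ k) ⟩
    ι (+ 9) * ι ((+ 9) ℤ.^ k)    ≈⟨ ≈-*ˡ (ℤ₍₂₎-ι (+ 9)) (ι9^≈1 k) ⟩
    ι (+ 9) * 1ℚ               ≈⟨ ≈-by two ℤ₍₂₎-2 refl ⟩
    1ℚ                         ∎
    where open ≈-Reasoning four

  ι3^odd≈3 : ∀ k → ι ((+ 3) ℤ.^ suc (2 ℕ.* k)) ≈ ι (+ 3) mod four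
  ι3^odd≈3 k = begin
    ι ((+ 3) ℤ.^ suc (2 ℕ.* k))          ≡⟨ ι-* (+ 3) ((+ 3) ℤ.^ (2 ℕ.* k)) ⟩
    ι (+ 3) * ι ((+ 3) ℤ.^ (2 ℕ.* k))    ≡⟨ cong (λ n → ι (+ 3) * ι n) (sym (ℤ.^-*-assoc (+ 3) 2 k)) ⟩
    ι (+ 3) * ι ((+ 9) ℤ.^ k)            ≈⟨ ≈-*ˡ (ℤ₍₂₎-ι (+ 3)) (ι9^≈1 k) ⟩
    ι (+ 3) * 1ℚ                       ≡⟨ ℚ.*-identityʳ (ι (+ 3)) ⟩
    ι (+ 3)                            ∎
    where open ≈-Reasoning four

  ι2^≈0 : ∀ k → ι ((+ 2) ℤ.^ suc (suc k)) ≈ 0ℚ mod four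
  ι2^≈0 k = ≈-by (ι ((+ 2) ℤ.^ k)) (ℤ₍₂₎-ι ((+ 2) ℤ.^ k)) (begin
    ι ((+ 2) ℤ.^ suc (suc k)) - 0ℚ            ≡⟨ ℚ.+-identityʳ (ι ((+ 2) ℤ.^ suc (suc k))) ⟩
    ι (+ 2 ℤ.* (+ 2 ℤ.* (+ 2) ℤ.^ k))         ≡⟨ ι-* (+ 2) (+ 2 ℤ.* (+ 2) ℤ.^ k) ⟩
    two * ι (+ 2 ℤ.* (+ 2) ℤ.^ k)             ≡⟨ cong (two *_) (ι-* (+ 2) ((+ 2) ℤ.^ k)) ⟩
    two * (two * ι ((+ 2) ℤ.^ k))             ≡⟨ sym (ℚ.*-assoc two two (ι ((+ 2) ℤ.^ k))) ⟩
    four * ι ((+ 2) ℤ.^ k)                    ∎)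
    where open ≡-Reasoning

  y²+z²-2wyz≉3 : ℤ₍₂₎ α → ℤ₍₂₎ β → ℤ₍₂₎ γ → ¬ (α * α + β * β - γ * (two * (α * β)) ≈ ι (+ 3) mod four)
  y²+z²-2wyz≉3 {α} {β} {γ} α∈ β∈ γ∈ Q≈3 = by-parity (parity α∈) (parity β∈)
    where
    Q : ℚ → ℚ → ℚ
    Q a b = a * a + b * b - γ * (two * (a * b))
    reduce : ∀ {a b} → ℤ₍₂₎ a → ℤ₍₂₎ b → α ≈ a mod two → β ≈ b mod two → Q a b ≈ ι (+ 3) mod four
    reduce a∈ b∈ α≈a β≈b = ≈-trans (≈-sym (≈-- (≈-+ (≈-square a∈ α≈a) (≈-square b∈ β≈b))
                                                (≈-*ˡ γ∈ (≈-scale two (≈-* a∈ β∈ α≈a β≈b))))) Q≈3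
    3≉0 : ¬ (ι (+ 3) ≈ 0ℚ mod two)
    3≉0 = odd≉0 1
    1≉3 : ¬ (1ℚ ≈ ι (+ 3) mod four)
    1≉3 1≈3 = two≉0 (≈-- (≈-sym 1≈3) (≈-refl {1ℚ}))
    by-parity : α ≈ 0ℚ mod two ⊎ α ≈ 1ℚ mod two → β ≈ 0ℚ mod two ⊎ β ≈ 1ℚ mod two → ⊥
    by-parity (inj₁ α≈0) (inj₁ β≈0) = 3≉0 (≈-weaken ℤ₍₂₎-2 (≈-sym (subst (λ q → q ≈ ι (+ 3) mod four)
      (solve 1 (λ γ → con 0ℚ :* con 0ℚ :+ con 0ℚ :* con 0ℚ :- γ :* (con two :* (con 0ℚ :* con 0ℚ)) := con 0ℚ) refl γ)
      (reduce ℤ₍₂₎-0 ℤ₍₂₎-0 α≈0 β≈0))))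
    by-parity (inj₁ α≈0) (inj₂ β≈1) = 1≉3 (subst (λ q → q ≈ ι (+ 3) mod four)
      (solve 1 (λ γ → con 0ℚ :* con 0ℚ :+ con 1ℚ :* con 1ℚ :- γ :* (con two :* (con 0ℚ :* con 1ℚ)) := con 1ℚ) refl γ)
      (reduce ℤ₍₂₎-0 ℤ₍₂₎-1 α≈0 β≈1))
    by-parity (inj₂ α≈1) (inj₁ β≈0) = 1≉3 (subst (λ q → q ≈ ι (+ 3) mod four)
      (solve 1 (λ γ → con 1ℚ :* con 1ℚ :+ con 0ℚ :* con 0ℚ :- γ :* (con two :* (con 1ℚ :* con 0ℚ)) := con 1ℚ) refl γ)
      (reduce ℤ₍₂₎-1 ℤ₍₂₎-0 α≈1 β≈0))
    by-parity (inj₂ α≈1) (inj₂ β≈1) = 3≉0 (≈-trans (≈-sym (≈-weaken ℤ₍₂₎-2 (reduce ℤ₍₂₎-1 ℤ₍₂₎-1 α≈1 β≈1)))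
      (subst (λ q → q ≈ 0ℚ mod two)
        (solve 1 (λ γ → con two :* (con 1ℚ :- γ) := con 1ℚ :* con 1ℚ :+ con 1ℚ :* con 1ℚ :- γ :* (con two :* (con 1ℚ :* con 1ℚ))) refl γ)
        (two*≈0 (ℤ₍₂₎-- ℤ₍₂₎-1 γ∈))))

module IntegralityAtTwo where

  open import Data.Nat as ℕ using (ℕ; zero; suc)
  open import Data.Integer as ℤ using (ℤ; +_)
  open import Data.Rational as ℚ using (ℚ; _+_; _*_; _-_; -_; 0ℚ; 1ℚ)
  import Data.Rational.Properties as ℚ
  open import Data.Rational.Solver using (module +-*-Solver)
  open import Data.List using ([]; _∷_)
  open import Data.Product using (_×_; _,_; proj₁; proj₂; ∃-syntax)
  open import Data.Sum using (_⊎_; inj₁; inj₂)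
  open import Relation.Nullary using (¬_)
  open import Relation.Binary.PropositionalEquality using (_≡_; _≢_; refl; sym; trans; cong; cong₂; subst; module ≡-Reasoning)
  open import Data.Empty using (⊥-elim)
  open import Data.Nat.Induction using (<-rec)
  import Data.Nat.Properties as ℕ
  import Data.Nat.DivMod as ℕ
  import Data.Integer.Properties as ℤ
  open Parity using (ℕ-parity)
  open import Defs using (K; tℚ; _+K_; _-K_; _*K_; _^K_; fromℤK; 0K; evalMonic; IsIntegral; In2OK; lhs; Odd)
  open LocalisationAtTwo
  open +-*-Solver

  infixr 7 _·_

  _·_ : ℚ → K → K
  c · (p , q) = (c * p , c * q)

  embed : ℚ → K
  embed a = (a , 0ℚ)

  -- p + q√t = (p − q) + 2q · (1 + √t)/2, so this is ℤ₍₂₎[(1 + √t)/2], the ring of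
  -- integers localised at 2 when t ≡ 1 (mod 4).
  record 𝒪₍₂₎ (x : K) : Set where
    constructor 𝒪-by
    field
      p-q∈ℤ₍₂₎ : ℤ₍₂₎ (proj₁ x - proj₂ x)
      2q∈ℤ₍₂₎ : ℤ₍₂₎ (two * proj₂ x)

  private
    variable
      x y : K
      c : ℚ

  𝒪-embed : ℤ₍₂₎ c → 𝒪₍₂₎ (embed c)
  𝒪-embed {c} c∈ = 𝒪-by (subst ℤ₍₂₎ (sym (ℚ.+-identityʳ c)) c∈) ℤ₍₂₎-0

  𝒪-pair : ∀ {p q} → ℤ₍₂₎ p → ℤ₍₂₎ q → 𝒪₍₂₎ (p , q)
  𝒪-pair p∈ q∈ = 𝒪-by (ℤ₍₂₎-- p∈ q∈) (ℤ₍₂₎-* ℤ₍₂₎-2 q∈)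

  ℤ₍₂₎-↧* : ∀ p → ℤ₍₂₎ (ι (+ ℚ.↧ₙ p) * p)
  ℤ₍₂₎-↧* p = subst ℤ₍₂₎ (trans (sym (p*↧p≡↥p p)) (ℚ.*-comm p _)) (ℤ₍₂₎-ι (ℚ.↥ p))

  𝒪-clear : ∀ x → ∃[ n ] 𝒪₍₂₎ (ι (+ suc n) · x)
  𝒪-clear (p@(ℚ.mkℚ _ a _) , q@(ℚ.mkℚ _ b _)) = b ℕ.+ a ℕ.* suc b , 𝒪-pair
    (subst ℤ₍₂₎ (trans (solve 3 (λ P Q p → Q :* (P :* p) := (P :* Q) :* p) refl (ι (+ suc a)) (ι (+ suc b)) p) (cong (_* p) D≡))
       (ℤ₍₂₎-* (ℤ₍₂₎-ι (+ suc b)) (ℤ₍₂₎-↧* p)))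
    (subst ℤ₍₂₎ (trans (solve 3 (λ P Q q → P :* (Q :* q) := (P :* Q) :* q) refl (ι (+ suc a)) (ι (+ suc b)) q) (cong (_* q) D≡))
       (ℤ₍₂₎-* (ℤ₍₂₎-ι (+ suc a)) (ℤ₍₂₎-↧* q)))
    where
    D≡ : ι (+ suc a) * ι (+ suc b) ≡ ι (+ (suc a ℕ.* suc b))
    D≡ = trans (sym (ι-* (+ suc a) (+ suc b))) (cong ι (sym (ℤ.pos-* (suc a) (suc b))))

  𝒪-cancel-odd : ∀ j → 𝒪₍₂₎ (odd j · x) → 𝒪₍₂₎ x
  𝒪-cancel-odd {p , q} j (𝒪-by a b) =
    𝒪-by (ℤ₍₂₎-cancel-odd j (subst ℤ₍₂₎ (solve 3 (λ o p q → o :* p :- o :* q := (p :- q) :* o) refl (odd j) p q) a))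
         (ℤ₍₂₎-cancel-odd j (subst ℤ₍₂₎ (solve 3 (λ o p q → con two :* (o :* q) := con two :* q :* o) refl (odd j) p q) b))

  module QuadraticField (t : ℕ) where

    infixl 6 _+ₖ_ _-ₖ_
    infixl 7 _*ₖ_
    infixr 8 _^ₖ_

    _+ₖ_ _-ₖ_ _*ₖ_ : K → K → K
    _+ₖ_ = _+K_ t
    _-ₖ_ = _-K_ t
    _*ₖ_ = _*K_ t

    _^ₖ_ : K → ℕ → K
    _^ₖ_ = _^K_ t

    𝒪-+ : 𝒪₍₂₎ x → 𝒪₍₂₎ y → 𝒪₍₂₎ (x +ₖ y)
    𝒪-+ {p , q} {p′ , q′} (𝒪-by a b) (𝒪-by a′ b′) =
      𝒪-by (subst ℤ₍₂₎ (solve 4 (λ p q p′ q′ → (p :- q) :+ (p′ :- q′) := (p :+ p′) :- (q :+ q′)) refl p q p′ q′) (ℤ₍₂₎-+ a a′))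
           (subst ℤ₍₂₎ (solve 2 (λ q q′ → con two :* q :+ con two :* q′ := con two :* (q :+ q′)) refl q q′) (ℤ₍₂₎-+ b b′))

    ·-horner-step : ∀ l Λ n x g → (l * Λ) · (fromℤK t n +ₖ x *ₖ g) ≡ embed (l * Λ * ι n) +ₖ (l · x) *ₖ (Λ · g)
    ·-horner-step l Λ n (p , q) (e , f) = cong₂ _,_
      (solve 8 (λ l Λ n p q e f t → (l :* Λ) :* (n :+ (p :* e :+ t :* (q :* f)))
                                := l :* Λ :* n :+ ((l :* p) :* (Λ :* e) :+ t :* ((l :* q) :* (Λ :* f)))) refl l Λ (ι n) p q e f (tℚ t))
      (solve 6 (λ l Λ p q e f → (l :* Λ) :* (con 0ℚ :+ (p :* f :+ q :* e))
                                := con 0ℚ :+ ((l :* p) :* (Λ :* f) :+ (l :* q) :* (Λ :* e))) refl l Λ p q e f)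

    -- s = 1 + 2J is a square root of t modulo 16, so p + q√t ↦ p + qs is a ring
    -- homomorphism 𝒪₍₂₎ → ℤ₍₂₎/4: the cross term 16W·qq′ = 4W·(2q)(2q′) vanishes mod 4.
    module SquareRoot (J W : ℚ) (J∈ : ℤ₍₂₎ J) (W∈ : ℤ₍₂₎ W)
                      (t≡ : tℚ t ≡ (1ℚ + two * J) * (1ℚ + two * J) + ι (+ 16) * W) where

      s : ℚ
      s = 1ℚ + two * J

      𝒪-* : 𝒪₍₂₎ x → 𝒪₍₂₎ y → 𝒪₍₂₎ (x *ₖ y)
      𝒪-* {p , q} {p′ , q′} (𝒪-by a b) (𝒪-by a′ b′) = 𝒪-by
        (subst ℤ₍₂₎ (begin
           (p - q) * (p′ - q′) + v * ((two * q) * (two * q′))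
             ≡⟨ solve 6 (λ p q p′ q′ J W → (p :- q) :* (p′ :- q′) :+ (J :+ J :* J :+ con (ι (+ 4)) :* W) :* ((con two :* q) :* (con two :* q′))
                   := (p :* p′ :+ ((con 1ℚ :+ con two :* J) :* (con 1ℚ :+ con two :* J) :+ con (ι (+ 16)) :* W) :* (q :* q′)) :- (p :* q′ :+ q :* p′))
                   refl p q p′ q′ J W ⟩
           (p * p′ + ((1ℚ + two * J) * (1ℚ + two * J) + ι (+ 16) * W) * (q * q′)) - (p * q′ + q * p′)
             ≡⟨ cong (λ u → (p * p′ + u * (q * q′)) - (p * q′ + q * p′)) (sym t≡) ⟩
           (p * p′ + tℚ t * (q * q′)) - (p * q′ + q * p′) ∎)
          (ℤ₍₂₎-+ (ℤ₍₂₎-* a a′) (ℤ₍₂₎-* v∈ (ℤ₍₂₎-* b b′))))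
        (subst ℤ₍₂₎ (solve 4 (λ p q p′ q′ → (p :- q) :* (con two :* q′) :+ (con two :* q) :* (p′ :- q′) :+ (con two :* q) :* (con two :* q′)
                                         := con two :* (p :* q′ :+ q :* p′)) refl p q p′ q′)
          (ℤ₍₂₎-+ (ℤ₍₂₎-+ (ℤ₍₂₎-* a b′) (ℤ₍₂₎-* b a′)) (ℤ₍₂₎-* b b′)))
        where
        open ≡-Reasoning
        v : ℚ
        v = J + J * J + ι (+ 4) * W
        v∈ : ℤ₍₂₎ v
        v∈ = ℤ₍₂₎-+ (ℤ₍₂₎-+ J∈ (ℤ₍₂₎-* J∈ J∈)) (ℤ₍₂₎-* (ℤ₍₂₎-ι (+ 4)) W∈)

      ρ : K → ℚ
      ρ (p , q) = p + q * s

      ρ-ℤ₍₂₎ : 𝒪₍₂₎ x → ℤ₍₂₎ (ρ x)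
      ρ-ℤ₍₂₎ {p , q} (𝒪-by a b) = subst ℤ₍₂₎
        (solve 3 (λ p q J → (p :- q) :+ (con two :* q) :* (con 1ℚ :+ J) := p :+ q :* (con 1ℚ :+ con two :* J)) refl p q J)
        (ℤ₍₂₎-+ a (ℤ₍₂₎-* b (ℤ₍₂₎-+ ℤ₍₂₎-1 J∈)))

      ρ-+ : ∀ x y → ρ (x +ₖ y) ≡ ρ x + ρ y
      ρ-+ (p , q) (p′ , q′) = solve 5 (λ p q p′ q′ s → (p :+ p′) :+ (q :+ q′) :* s := (p :+ q :* s) :+ (p′ :+ q′ :* s)) refl p q p′ q′ s

      ρ-embed : ∀ c → ρ (embed c) ≡ c
      ρ-embed c = solve 2 (λ c s → c :+ con 0ℚ :* s := c) refl c s

      ρ-* : 𝒪₍₂₎ x → 𝒪₍₂₎ y → ρ (x *ₖ y) ≈ ρ x * ρ y mod four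
      ρ-* {p , q} {p′ , q′} (𝒪-by _ b) (𝒪-by _ b′) = ≈-by (W * ((two * q) * (two * q′))) (ℤ₍₂₎-* W∈ (ℤ₍₂₎-* b b′)) (begin
        ρ ((p , q) *ₖ (p′ , q′)) - ρ (p , q) * ρ (p′ , q′)
          ≡⟨ cong (λ u → ((p * p′ + u * (q * q′)) + (p * q′ + q * p′) * s) - ρ (p , q) * ρ (p′ , q′)) t≡ ⟩
        ((p * p′ + (s * s + ι (+ 16) * W) * (q * q′)) + (p * q′ + q * p′) * s) - (p + q * s) * (p′ + q′ * s)
          ≡⟨ solve 6 (λ p q p′ q′ s W → ((p :* p′ :+ (s :* s :+ con (ι (+ 16)) :* W) :* (q :* q′)) :+ (p :* q′ :+ q :* p′) :* s)
                                         :- (p :+ q :* s) :* (p′ :+ q′ :* s)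
                                     := con four :* (W :* ((con two :* q) :* (con two :* q′)))) refl p q p′ q′ s W ⟩
        four * (W * ((two * q) * (two * q′))) ∎)
        where open ≡-Reasoning

      ρ-- : ∀ x y → ρ (x -ₖ y) ≡ ρ x - ρ y
      ρ-- (p , q) (p′ , q′) = solve 5 (λ p q p′ q′ s → (p :- p′) :+ (q :- q′) :* s := (p :+ q :* s) :- (p′ :+ q′ :* s)) refl p q p′ q′ s

      ρ-ι*ₖ : ∀ n x → ρ (fromℤK t n *ₖ x) ≡ ι n * ρ x
      ρ-ι*ₖ n (p , q) = solve 5 (λ n p q s t → (n :* p :+ t :* (con 0ℚ :* q)) :+ (n :* q :+ con 0ℚ :* p) :* s := n :* (p :+ q :* s))
                                refl (ι n) p q s (tℚ t)

      ρ-ι^ : ∀ n k → ρ (fromℤK t n ^ₖ k) ≡ ι (n ℤ.^ k)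
      ρ-ι^ n zero = ρ-embed 1ℚ
      ρ-ι^ n (suc k) = begin
        ρ (fromℤK t n *ₖ fromℤK t n ^ₖ k)   ≡⟨ ρ-ι*ₖ n (fromℤK t n ^ₖ k) ⟩
        ι n * ρ (fromℤK t n ^ₖ k)           ≡⟨ cong (ι n *_) (ρ-ι^ n k) ⟩
        ι n * ι (n ℤ.^ k)                   ≡⟨ sym (ι-* n (n ℤ.^ k)) ⟩
        ι (n ℤ.^ suc k)                     ∎
        where open ≡-Reasoning

      𝒪-^ : 𝒪₍₂₎ x → ∀ k → 𝒪₍₂₎ (x ^ₖ k)
      𝒪-^ x∈ zero = 𝒪-embed ℤ₍₂₎-1
      𝒪-^ x∈ (suc k) = 𝒪-* x∈ (𝒪-^ x∈ k)

      ρ-*≈0ˡ : 𝒪₍₂₎ x → 𝒪₍₂₎ y → ρ x ≈ 0ℚ mod four → ρ (x *ₖ y) ≈ 0ℚ mod four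
      ρ-*≈0ˡ {x} {y} x∈ y∈ ρx≈0 = ≈-trans (ρ-* x∈ y∈) (≈-trans (≈-*ʳ (ρ-ℤ₍₂₎ y∈) ρx≈0) (≈-reflexive (ℚ.*-zeroˡ (ρ y))))

      ρ-*≈0ʳ : 𝒪₍₂₎ x → 𝒪₍₂₎ y → ρ y ≈ 0ℚ mod four → ρ (x *ₖ y) ≈ 0ℚ mod four
      ρ-*≈0ʳ {x} {y} x∈ y∈ ρy≈0 = ≈-trans (ρ-* x∈ y∈) (≈-trans (≈-*ˡ (ρ-ℤ₍₂₎ x∈) ρy≈0) (≈-reflexive (ℚ.*-zeroʳ (ρ x))))

      ρ-*-even : 𝒪₍₂₎ x → 𝒪₍₂₎ y → ρ x ≈ 0ℚ mod two → ρ y ≈ 0ℚ mod two → ρ (x *ₖ y) ≈ 0ℚ mod four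
      ρ-*-even x∈ y∈ ρx≈0 ρy≈0 = ≈-trans (ρ-* x∈ y∈) (≈0-* ρx≈0 ρy≈0)

      ρ-*-evenˡ : 𝒪₍₂₎ x → 𝒪₍₂₎ y → ρ x ≈ 0ℚ mod two → ρ (x *ₖ y) ≈ 0ℚ mod two
      ρ-*-evenˡ {x} {y} x∈ y∈ ρx≈0 = ≈-trans (≈-weaken ℤ₍₂₎-2 (ρ-* x∈ y∈))
                                             (≈-trans (≈-*ʳ (ρ-ℤ₍₂₎ y∈) ρx≈0) (≈-reflexive (ℚ.*-zeroˡ (ρ y))))

      ρ-^-even : 𝒪₍₂₎ x → ρ x ≈ 0ℚ mod two → ∀ k → ρ (x ^ₖ suc (suc k)) ≈ 0ℚ mod four
      ρ-^-even x∈ ρx≈0 k = ρ-*-even x∈ (𝒪-* x∈ (𝒪-^ x∈ k)) ρx≈0 (ρ-*-evenˡ x∈ (𝒪-^ x∈ k) ρx≈0)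

      -- If l is even and y = l·x has odd reduction, then lⁿ·f(x) = yⁿ + (even terms) for
      -- monic f of degree n, so its reduction is odd as well.
      odd-monic-value : ∀ {l x} → l ≈ 0ℚ mod two → 𝒪₍₂₎ (l · x) → ρ (l · x) ≈ 1ℚ mod two → ∀ cs →
                        ∃[ Λ ] ℤ₍₂₎ Λ × 𝒪₍₂₎ (Λ · evalMonic t cs x) × ρ (Λ · evalMonic t cs x) ≈ 1ℚ mod two
      odd-monic-value l≈0 y∈ ρy≈1 [] = 1ℚ , ℤ₍₂₎-1 , 𝒪-embed ℤ₍₂₎-1 , ≈-reflexive (ρ-embed 1ℚ)
      odd-monic-value {l} {x} l≈0 y∈ ρy≈1 (n ∷ cs) with odd-monic-value l≈0 y∈ ρy≈1 cs
      ... | Λ , Λ∈ , z∈ , ρz≈1 = l * Λ , ℤ₍₂₎-* l∈ Λ∈ ,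
        subst 𝒪₍₂₎ (sym step) (𝒪-+ (𝒪-embed a∈) (𝒪-* y∈ z∈)) , (begin
          ρ ((l * Λ) · evalMonic t (n ∷ cs) x)       ≡⟨ cong ρ step ⟩
          ρ (embed a +ₖ (l · x) *ₖ (Λ · g))          ≡⟨ trans (ρ-+ (embed a) ((l · x) *ₖ (Λ · g))) (cong (_+ ρ ((l · x) *ₖ (Λ · g))) (ρ-embed a)) ⟩
          a + ρ ((l · x) *ₖ (Λ · g))                 ≈⟨ ≈-+ a≈0 (≈-weaken ℤ₍₂₎-2 (ρ-* y∈ z∈)) ⟩
          0ℚ + ρ (l · x) * ρ (Λ · g)                 ≈⟨ ≈-+ ≈-refl (≈-* ℤ₍₂₎-1 (ρ-ℤ₍₂₎ z∈) ρy≈1 ρz≈1) ⟩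
          0ℚ + 1ℚ * 1ℚ                               ≡⟨⟩
          1ℚ                                         ∎)
        where
        open ≈-Reasoning two
        g : K
        g = evalMonic t cs x
        a : ℚ
        a = l * Λ * ι n
        l∈ : ℤ₍₂₎ l
        l∈ = ≈-ℤ₍₂₎ ℤ₍₂₎-2 ℤ₍₂₎-0 l≈0
        a∈ : ℤ₍₂₎ a
        a∈ = ℤ₍₂₎-* (ℤ₍₂₎-* l∈ Λ∈) (ℤ₍₂₎-ι n)
        a≈0 : a ≈ 0ℚ mod two
        a≈0 = ≈-trans (subst (λ u → u ≈ 0ℚ * (Λ * ι n) mod two) (sym (ℚ.*-assoc l Λ (ι n))) (≈-*ʳ (ℤ₍₂₎-* Λ∈ (ℤ₍₂₎-ι n)) l≈0))
                      (≈-reflexive (ℚ.*-zeroˡ (Λ * ι n)))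
        step : (l * Λ) · evalMonic t (n ∷ cs) x ≡ embed a +ₖ (l · x) *ₖ (Λ · g)
        step = ·-horner-step l Λ n x g

      not-root : ∀ {l x} → l ≈ 0ℚ mod two → 𝒪₍₂₎ (l · x) → ρ (l · x) ≈ 1ℚ mod two → ∀ cs → evalMonic t cs x ≢ 0K t
      not-root l≈0 y∈ ρy≈1 cs root with odd-monic-value l≈0 y∈ ρy≈1 cs
      ... | Λ , _ , _ , ρz≈1 = odd≉0 0 (≈-trans (≈-sym (subst (λ z → ρ (Λ · z) ≈ 1ℚ mod two) root ρz≈1))
                                                (≈-reflexive (solve 2 (λ Λ s → Λ :* con 0ℚ :+ Λ :* con 0ℚ :* s := con 0ℚ) refl Λ s)))

    -- Since 2 splits in ℚ(√t), the reductions at the two square roots s and −s of t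
    -- together detect divisibility by 2 in 𝒪₍₂₎.
    module Integrality (J W : ℚ) (J∈ : ℤ₍₂₎ J) (W∈ : ℤ₍₂₎ W)
                       (t≡ : tℚ t ≡ (1ℚ + two * J) * (1ℚ + two * J) + ι (+ 16) * W) where

      module +s = SquareRoot J W J∈ W∈ t≡
      module -s = SquareRoot (- 1ℚ - J) W (ℤ₍₂₎-- (ℤ₍₂₎-neg ℤ₍₂₎-1) J∈) W∈ (trans t≡ (cong (_+ ι (+ 16) * W)
        (solve 1 (λ J → (con 1ℚ :+ con two :* J) :* (con 1ℚ :+ con two :* J)
                    := (con 1ℚ :+ con two :* (:- con 1ℚ :- J)) :* (con 1ℚ :+ con two :* (:- con 1ℚ :- J))) refl J)))

      𝒪-halve : 𝒪₍₂₎ x → +s.ρ x ≈ 0ℚ mod two → -s.ρ x ≈ 0ℚ mod two → 𝒪₍₂₎ (half · x)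
      𝒪-halve {p , q} (𝒪-by _ b) ρ₊≈0 ρ₋≈0 = 𝒪-by
        (subst ℤ₍₂₎ (solve 3 (λ p q J → con half :* (p :+ q :* (con 1ℚ :+ con two :* J)) :- q :* (con 1ℚ :+ J)
                                    := con half :* p :- con half :* q) refl p q J)
          (ℤ₍₂₎-- (≈0⇒half∈ℤ₍₂₎ ρ₊≈0) (ℤ₍₂₎-* q∈ (ℤ₍₂₎-+ ℤ₍₂₎-1 J∈))))
        (subst ℤ₍₂₎ (solve 1 (λ q → q := con two :* (con half :* q)) refl q) q∈)
        where
        q∈ : ℤ₍₂₎ q
        q∈ = subst ℤ₍₂₎ (solve 3 (λ p q J → con half :* (p :+ q :* (con 1ℚ :+ con two :* J))
                                           :- con half :* (p :+ q :* (con 1ℚ :+ con two :* (:- con 1ℚ :- J)))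
                                           :- con two :* q :* J := q) refl p q J)
               (ℤ₍₂₎-- (ℤ₍₂₎-- (≈0⇒half∈ℤ₍₂₎ ρ₊≈0) (≈0⇒half∈ℤ₍₂₎ ρ₋≈0)) (ℤ₍₂₎-* b J∈))

      𝒪-descend : ∀ {cs μ x} → evalMonic t cs x ≡ 0K t → ℤ₍₂₎ μ → 𝒪₍₂₎ ((two * μ) · x) → 𝒪₍₂₎ (μ · x)
      𝒪-descend {cs} {μ} {x} root μ∈ y∈ = by-parity (parity (+s.ρ-ℤ₍₂₎ y∈)) (parity (-s.ρ-ℤ₍₂₎ y∈))
        where
        z : K
        z = (two * μ) · x
        half·z : half · z ≡ μ · x
        half·z = cong₂ _,_ (solve 2 (λ μ p → con half :* (con two :* μ :* p) := μ :* p) refl μ (proj₁ x))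
                           (solve 2 (λ μ q → con half :* (con two :* μ :* q) := μ :* q) refl μ (proj₂ x))
        by-parity : +s.ρ z ≈ 0ℚ mod two ⊎ +s.ρ z ≈ 1ℚ mod two → -s.ρ z ≈ 0ℚ mod two ⊎ -s.ρ z ≈ 1ℚ mod two → 𝒪₍₂₎ (μ · x)
        by-parity (inj₂ ρ₊≈1) _           = ⊥-elim (+s.not-root (two*≈0 μ∈) y∈ ρ₊≈1 cs root)
        by-parity (inj₁ _)    (inj₂ ρ₋≈1) = ⊥-elim (-s.not-root (two*≈0 μ∈) y∈ ρ₋≈1 cs root)
        by-parity (inj₁ ρ₊≈0) (inj₁ ρ₋≈0) = subst 𝒪₍₂₎ half·z (𝒪-halve y∈ ρ₊≈0 ρ₋≈0)

      -- Strong induction on the denominator: odd factors are units of ℤ₍₂₎, factors 2 are removed by 𝒪-descend.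
      𝒪-of-multiple : ∀ {cs x} → evalMonic t cs x ≡ 0K t → ∀ n → 𝒪₍₂₎ (ι (+ suc n) · x) → 𝒪₍₂₎ x
      𝒪-of-multiple {cs} {x} root = <-rec (λ n → 𝒪₍₂₎ (ι (+ suc n) · x) → 𝒪₍₂₎ x) step
        where
        step : ∀ n → (∀ {m} → m ℕ.< n → 𝒪₍₂₎ (ι (+ suc m) · x) → 𝒪₍₂₎ x) → 𝒪₍₂₎ (ι (+ suc n) · x) → 𝒪₍₂₎ x
        step n rec nx∈ with ℕ-parity (suc n)
        ... | inj₂ (k , e) = 𝒪-cancel-odd k (subst (λ d → 𝒪₍₂₎ (ι (+ d) · x)) e nx∈)
        ... | inj₁ (suc m , e) = rec m<n (𝒪-descend root (ℤ₍₂₎-ι (+ suc m)) (subst (λ d → 𝒪₍₂₎ (d · x)) ι[2m] nx∈))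
          where
          m<n : m ℕ.< n
          m<n = subst (m ℕ.<_) (sym (ℕ.suc-injective e)) (ℕ.m<m+n m (ℕ.s≤s ℕ.z≤n))
          ι[2m] : ι (+ suc n) ≡ two * ι (+ suc m)
          ι[2m] = trans (cong (λ d → ι (+ d)) e) (trans (cong ι (ℤ.pos-* 2 (suc m))) (ι-* (+ 2) (+ suc m)))

      𝒪-of-integral : IsIntegral t x → 𝒪₍₂₎ x
      𝒪-of-integral {x} (cs , root) with 𝒪-clear x
      ... | n , nx∈ = 𝒪-of-multiple root n nx∈

      open +s

      ρ-lhs : ∀ {a b x y z w} → 𝒪₍₂₎ a → 𝒪₍₂₎ b → 𝒪₍₂₎ y → 𝒪₍₂₎ z → 𝒪₍₂₎ w → x ≡ fromℤK t (+ 2) *ₖ w → ∀ k j →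
              ρ (lhs t a b (2 ℕ.+ k) (suc (2 ℕ.* j)) x y z)
                ≈ ι (+ 3) - (ρ y * ρ y + ρ z * ρ z - ρ w * (two * (ρ y * ρ z))) mod four
      ρ-lhs {a} {b} {x} {y} {z} {w} a∈ b∈ y∈ z∈ w∈ x≡2w k j = begin
        ρ (lhs t a b d r x y z)
          ≡⟨ trans (ρ-- (a *ₖ x ^ₖ d -ₖ y *ₖ y -ₖ z *ₖ z +ₖ x *ₖ (y *ₖ z)) (2^d *ₖ b -ₖ 3^r)) (cong₂ _-_
              (trans (ρ-+ (a *ₖ x ^ₖ d -ₖ y *ₖ y -ₖ z *ₖ z) (x *ₖ (y *ₖ z))) (cong (_+ ρ (x *ₖ (y *ₖ z)))
                (trans (ρ-- (a *ₖ x ^ₖ d -ₖ y *ₖ y) (z *ₖ z)) (cong (_- ρ (z *ₖ z)) (ρ-- (a *ₖ x ^ₖ d) (y *ₖ y))))))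
              (ρ-- (2^d *ₖ b) 3^r)) ⟩
        ρ (a *ₖ x ^ₖ d) - ρ (y *ₖ y) - ρ (z *ₖ z) + ρ (x *ₖ (y *ₖ z)) - (ρ (2^d *ₖ b) - ρ 3^r)
          ≈⟨ ≈-- (≈-+ (≈-- (≈-- (ρ-*≈0ʳ a∈ (𝒪-^ x∈ d) (ρ-^-even x∈ ρx≈0 k)) (ρ-* y∈ y∈)) (ρ-* z∈ z∈)) xyz≈)
                 (≈-- (ρ-*≈0ˡ (𝒪-^ (𝒪-embed ℤ₍₂₎-2) d) b∈ (subst (λ u → u ≈ 0ℚ mod four) (sym (ρ-ι^ (+ 2) d)) (ι2^≈0 k)))
                      (subst (λ u → u ≈ ι (+ 3) mod four) (sym (ρ-ι^ (+ 3) r)) (ι3^odd≈3 j))) ⟩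
        0ℚ - Y * Y - Z * Z + two * V * (Y * Z) - (0ℚ - ι (+ 3))
          ≡⟨ solve 3 (λ Y Z V → con 0ℚ :- Y :* Y :- Z :* Z :+ con two :* V :* (Y :* Z) :- (con 0ℚ :- con (ι (+ 3)))
                             := con (ι (+ 3)) :- (Y :* Y :+ Z :* Z :- V :* (con two :* (Y :* Z)))) refl Y Z V ⟩
        ι (+ 3) - (Y * Y + Z * Z - V * (two * (Y * Z))) ∎
        where
        open ≈-Reasoning four
        d r : ℕ
        d = 2 ℕ.+ k
        r = suc (2 ℕ.* j)
        Y Z V : ℚ
        Y = ρ y
        Z = ρ z
        V = ρ w
        2^d 3^r : K
        2^d = fromℤK t (+ 2) ^ₖ d
        3^r = fromℤK t (+ 3) ^ₖ r
        x∈ : 𝒪₍₂₎ x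
        x∈ = subst 𝒪₍₂₎ (sym x≡2w) (𝒪-* (𝒪-embed ℤ₍₂₎-2) w∈)
        ρx≡ : ρ x ≡ two * V
        ρx≡ = trans (cong ρ x≡2w) (ρ-ι*ₖ (+ 2) w)
        ρx≈0 : ρ x ≈ 0ℚ mod two
        ρx≈0 = subst (λ u → u ≈ 0ℚ mod two) (sym ρx≡) (two*≈0 (ρ-ℤ₍₂₎ w∈))
        xyz≈ : ρ (x *ₖ (y *ₖ z)) ≈ two * V * (Y * Z) mod four
        xyz≈ = ≈-trans (ρ-* x∈ (𝒪-* y∈ z∈)) (subst (λ u → u * ρ (y *ₖ z) ≈ two * V * (Y * Z) mod four) (sym ρx≡)
                 (≈-*ˡ (ℤ₍₂₎-* ℤ₍₂₎-2 (ρ-ℤ₍₂₎ w∈)) (ρ-* y∈ z∈)))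

      no-solution : ∀ a b → IsIntegral t a → IsIntegral t b → ∀ r d → 2 ℕ.≤ d → Odd r →
                    ¬ (∃[ x ] ∃[ y ] ∃[ z ] (IsIntegral t x × IsIntegral t y × IsIntegral t z × In2OK t x
                        × lhs t a b d r x y z ≡ 0K t))
      no-solution a b a-int b-int .(suc (2 ℕ.* j)) (suc (suc k)) (ℕ.s≤s (ℕ.s≤s ℕ.z≤n)) (j , refl)
                  (x , y , z , _ , y-int , z-int , (w , w-int , x≡2w) , root) =
        y²+z²-2wyz≉3 (ρ-ℤ₍₂₎ y∈) (ρ-ℤ₍₂₎ z∈) (ρ-ℤ₍₂₎ w∈) (begin
          Q                    ≡⟨ solve 1 (λ Q → Q := con (ι (+ 3)) :- (con (ι (+ 3)) :- Q)) refl Q ⟩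
          ι (+ 3) - (ι (+ 3) - Q)
            ≈⟨ ≈-- (≈-refl {ι (+ 3)}) (≈-sym (ρ-lhs (𝒪-of-integral a-int) (𝒪-of-integral b-int) y∈ z∈ w∈ x≡2w k j)) ⟩
          ι (+ 3) - ρ (lhs t a b (suc (suc k)) (suc (2 ℕ.* j)) x y z)
            ≡⟨ cong (λ u → ι (+ 3) - ρ u) root ⟩
          ι (+ 3) - ρ (0K t)   ≡⟨ cong (λ u → ι (+ 3) - u) (ρ-embed 0ℚ) ⟩
          ι (+ 3) - 0ℚ         ≡⟨ ℚ.+-identityʳ (ι (+ 3)) ⟩
          ι (+ 3)              ∎)
        where
        open ≈-Reasoning four
        y∈ : 𝒪₍₂₎ y
        y∈ = 𝒪-of-integral y-int
        z∈ : 𝒪₍₂₎ z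
        z∈ = 𝒪-of-integral z-int
        w∈ : 𝒪₍₂₎ w
        w∈ = 𝒪-of-integral w-int
        Q : ℚ
        Q = ρ y * ρ y + ρ z * ρ z - ρ w * (two * (ρ y * ρ z))

  no-solution : ∀ t → t ℕ.% 8 ≡ 1 → ∀ a b → IsIntegral t a → IsIntegral t b → ∀ r d → 2 ℕ.≤ d → Odd r →
                ¬ (∃[ x ] ∃[ y ] ∃[ z ] (IsIntegral t x × IsIntegral t y × IsIntegral t z × In2OK t x
                    × lhs t a b d r x y z ≡ 0K t))
  no-solution t t%8≡1 = QuadraticField.Integrality.no-solution t J W J∈ W∈ t≡
    where
    u J W : ℚ
    u = ι (+ (t ℕ./ 8))
    J = two * u - 1ℚ
    W = u - u * u
    u∈ : ℤ₍₂₎ u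
    u∈ = ℤ₍₂₎-ι (+ (t ℕ./ 8))
    J∈ : ℤ₍₂₎ J
    J∈ = ℤ₍₂₎-- (ℤ₍₂₎-* ℤ₍₂₎-2 u∈) ℤ₍₂₎-1
    W∈ : ℤ₍₂₎ W
    W∈ = ℤ₍₂₎-- u∈ (ℤ₍₂₎-* u∈ u∈)
    -- s = 1 + 2J = 4u − 1 satisfies s² = t − 16(u − u²) when t = 8u + 1
    t≡ : tℚ t ≡ (1ℚ + two * J) * (1ℚ + two * J) + ι (+ 16) * W
    t≡ = begin
      ι (+ t)                          ≡⟨ cong (λ n → ι (+ n)) (trans (ℕ.m≡m%n+[m/n]*n t 8) (cong (ℕ._+ t ℕ./ 8 ℕ.* 8) t%8≡1)) ⟩
      ι (+ (1 ℕ.+ t ℕ./ 8 ℕ.* 8))      ≡⟨ cong ι (trans (ℤ.pos-+ 1 (t ℕ./ 8 ℕ.* 8)) (cong (λ v → + 1 ℤ.+ v) (ℤ.pos-* (t ℕ./ 8) 8))) ⟩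
      ι (+ 1 ℤ.+ + (t ℕ./ 8) ℤ.* + 8)  ≡⟨ trans (ι-+ (+ 1) (+ (t ℕ./ 8) ℤ.* + 8)) (cong (λ v → 1ℚ + v) (ι-* (+ (t ℕ./ 8)) (+ 8))) ⟩
      1ℚ + u * ι (+ 8)                 ≡⟨ solve 1 (λ u → con 1ℚ :+ u :* con (ι (+ 8))
                                                := (con 1ℚ :+ con two :* (con two :* u :- con 1ℚ)) :* (con 1ℚ :+ con two :* (con two :* u :- con 1ℚ))
                                                   :+ con (ι (+ 16)) :* (u :- u :* u)) refl u ⟩
      (1ℚ + two * J) * (1ℚ + two * J) + ι (+ 16) * W ∎
      where open ≡-Reasoning

module Counting where

  open import Data.Bool using (Bool; true; false; T; _∨_)
  open import Data.Nat as ℕ using (ℕ; zero; suc; _+_; _*_; _≤_; _<_; z≤n; s≤s; _/_; _%_; NonZero)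
  open import Data.Nat.Properties
  open import Algebra.Properties.CommutativeSemigroup +-commutativeSemigroup using (interchange)
  import Data.Nat.DivMod as ℕ
  open import Data.Nat.Solver using (module +-*-Solver)
  open import Data.List using (List; []; _∷_; map; length; filterᵇ; applyUpTo)
  open import Data.Nat.ListAction using (sum)
  open import Data.Empty using (⊥-elim)
  open import Data.Product using (_×_; _,_)
  open import Function using (_∘_; id)
  open import Relation.Binary.PropositionalEquality
  open import Defs using (countUpTo)
  open +-*-Solver using (solve; _:+_; _:*_; _:=_)

  ⟦_⟧ : Bool → ℕ
  ⟦ true ⟧ = 1
  ⟦ false ⟧ = 0

  count : (ℕ → Bool) → ℕ → ℕ
  count P zero = 0
  count P (suc n) = count P n + ⟦ P n ⟧

  private
    variable
      P Q : ℕ → Bool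

  ⟦⟧-mono : ∀ {a b} → (T a → T b) → ⟦ a ⟧ ≤ ⟦ b ⟧
  ⟦⟧-mono {false} _ = z≤n
  ⟦⟧-mono {true} {true} _ = ≤-refl
  ⟦⟧-mono {true} {false} f = ⊥-elim (f _)

  ⟦⟧-∨ : ∀ a b → ⟦ a ∨ b ⟧ ≤ ⟦ a ⟧ + ⟦ b ⟧
  ⟦⟧-∨ true _ = s≤s z≤n
  ⟦⟧-∨ false _ = ≤-refl

  count-≤ : ∀ P n → count P n ≤ n
  count-≤ P zero = z≤n
  count-≤ P (suc n) = subst (count P n + ⟦ P n ⟧ ≤_) (+-comm n 1) (+-mono-≤ (count-≤ P n) (⟦≤1⟧ (P n)))
    where
    ⟦≤1⟧ : ∀ b → ⟦ b ⟧ ≤ 1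
    ⟦≤1⟧ true = ≤-refl
    ⟦≤1⟧ false = z≤n

  count-cong : ∀ n → (∀ k → k < n → P k ≡ Q k) → count P n ≡ count Q n
  count-cong zero _ = refl
  count-cong (suc n) P≡Q = cong₂ _+_ (count-cong n (λ k k<n → P≡Q k (m≤n⇒m≤1+n k<n))) (cong ⟦_⟧ (P≡Q n ≤-refl))

  count-mono : ∀ n → (∀ k → k < n → T (P k) → T (Q k)) → count P n ≤ count Q n
  count-mono zero _ = z≤n
  count-mono (suc n) P⇒Q = +-mono-≤ (count-mono n (λ k k<n → P⇒Q k (m≤n⇒m≤1+n k<n))) (⟦⟧-mono (P⇒Q n ≤-refl))

  count-∨ : ∀ P Q n → count (λ k → P k ∨ Q k) n ≤ count P n + count Q n
  count-∨ P Q zero = z≤n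
  count-∨ P Q (suc n) = begin
    count (λ k → P k ∨ Q k) n + ⟦ P n ∨ Q n ⟧         ≤⟨ +-mono-≤ (count-∨ P Q n) (⟦⟧-∨ (P n) (Q n)) ⟩
    (count P n + count Q n) + (⟦ P n ⟧ + ⟦ Q n ⟧)     ≡⟨ interchange (count P n) (count Q n) ⟦ P n ⟧ ⟦ Q n ⟧ ⟩
    (count P n + ⟦ P n ⟧) + (count Q n + ⟦ Q n ⟧)     ∎
    where open ≤-Reasoning

  count-Σ : ∀ P (Qs : List (ℕ → Bool)) n → (∀ k → ⟦ P k ⟧ ≡ sum (map (λ Q → ⟦ Q k ⟧) Qs)) →
            count P n ≡ sum (map (λ Q → count Q n) Qs)
  count-Σ P Qs zero P≡Σ = sym (Σ0 Qs)
    where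
    Σ0 : ∀ (Qs : List (ℕ → Bool)) → sum (map (λ Q → count Q 0) Qs) ≡ 0
    Σ0 [] = refl
    Σ0 (_ ∷ Qs) = Σ0 Qs
  count-Σ P Qs (suc n) P≡Σ = begin
    count P n + ⟦ P n ⟧                                         ≡⟨ cong₂ _+_ (count-Σ P Qs n P≡Σ) (P≡Σ n) ⟩
    sum (map (λ Q → count Q n) Qs) + sum (map (λ Q → ⟦ Q n ⟧) Qs) ≡⟨ Σ-+ Qs ⟩
    sum (map (λ Q → count Q (suc n)) Qs)                        ∎
    where
    open ≡-Reasoning
    Σ-+ : ∀ (Qs : List (ℕ → Bool)) →
          sum (map (λ Q → count Q n) Qs) + sum (map (λ Q → ⟦ Q n ⟧) Qs) ≡ sum (map (λ Q → count Q (suc n)) Qs)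
    Σ-+ [] = refl
    Σ-+ (Q ∷ Qs) = trans (interchange (count Q n) (sum (map (λ Q → count Q n) Qs)) ⟦ Q n ⟧ (sum (map (λ Q → ⟦ Q n ⟧) Qs)))
                         (cong (count Q (suc n) +_) (Σ-+ Qs))

  count-suc : ∀ P n → count P (suc n) ≡ ⟦ P 0 ⟧ + count (P ∘ suc) n
  count-suc P zero = +-comm 0 ⟦ P 0 ⟧
  count-suc P (suc n) = trans (cong (_+ ⟦ P (suc n) ⟧) (count-suc P n)) (+-assoc ⟦ P 0 ⟧ _ _)

  countUpTo≡count : ∀ P X → countUpTo P X ≡ ⟦ P 0 ⟧ + count (P ∘ suc) X
  countUpTo≡count P X = trans (length-filter-applyUpTo id (suc X)) (count-suc P X)
    where
    length-filter-applyUpTo : ∀ f n → length (filterᵇ P (applyUpTo f n)) ≡ count (P ∘ f) n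
    length-filter-applyUpTo f zero = refl
    length-filter-applyUpTo f (suc n) with P (f 0) in eq
    ... | true  = trans (cong suc (length-filter-applyUpTo (f ∘ suc) n)) (sym (trans (count-suc (P ∘ f) n) (cong (λ b → ⟦ b ⟧ + count (P ∘ f ∘ suc) n) eq)))
    ... | false = trans (length-filter-applyUpTo (f ∘ suc) n) (sym (trans (count-suc (P ∘ f) n) (cong (λ b → ⟦ b ⟧ + count (P ∘ f ∘ suc) n) eq)))

  count-+ : ∀ P m n → count P (m + n) ≡ count P m + count (λ k → P (m + k)) n
  count-+ P m zero = trans (cong (count P) (+-identityʳ m)) (sym (+-identityʳ (count P m)))
  count-+ P m (suc n) = begin
    count P (m + suc n)                                     ≡⟨ cong (count P) (+-suc m n) ⟩
    count P (m + n) + ⟦ P (m + n) ⟧                         ≡⟨ cong (_+ ⟦ P (m + n) ⟧) (count-+ P m n) ⟩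
    count P m + count (λ k → P (m + k)) n + ⟦ P (m + n) ⟧   ≡⟨ +-assoc (count P m) _ _ ⟩
    count P m + count (λ k → P (m + k)) (suc n)             ∎
    where open ≡-Reasoning

  Periodic : (ℕ → Bool) → ℕ → Set
  Periodic P L = ∀ k → P (L + k) ≡ P k

  count-periodic : ∀ P L → Periodic P L → ∀ q r → count P (q * L + r) ≡ q * count P L + count P r
  count-periodic P L P-per zero r = refl
  count-periodic P L P-per (suc q) r = begin
    count P (L + q * L + r)                          ≡⟨ cong (count P) (+-assoc L (q * L) r) ⟩
    count P (L + (q * L + r))                        ≡⟨ count-+ P L (q * L + r) ⟩
    count P L + count (λ k → P (L + k)) (q * L + r)  ≡⟨ cong (count P L +_) (count-cong (q * L + r) (λ k _ → P-per k)) ⟩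
    count P L + count P (q * L + r)                  ≡⟨ cong (count P L +_) (count-periodic P L P-per q r) ⟩
    count P L + (q * count P L + count P r)          ≡⟨ sym (+-assoc (count P L) _ _) ⟩
    count P L + q * count P L + count P r            ∎
    where open ≡-Reasoning

  count-rotate : ∀ P L → Periodic P L → ∀ s → count (λ k → P (s + k)) L ≡ count P L
  count-rotate P L P-per zero = refl
  count-rotate P L P-per (suc s) = begin
    count (λ k → P (suc s + k)) L   ≡⟨ count-cong L (λ k _ → cong P (sym (+-suc s k))) ⟩
    count (Pₛ ∘ suc) L              ≡⟨ +-cancelˡ-≡ ⟦ Pₛ 0 ⟧ _ _ (begin
        ⟦ Pₛ 0 ⟧ + count (Pₛ ∘ suc) L   ≡⟨ sym (count-suc Pₛ L) ⟩
        count Pₛ L + ⟦ Pₛ L ⟧           ≡⟨ cong (λ n → count Pₛ L + ⟦ P n ⟧) (trans (+-comm s L) (cong (L +_) (sym (+-identityʳ s)))) ⟩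
        count Pₛ L + ⟦ P (L + (s + 0)) ⟧ ≡⟨ cong (λ b → count Pₛ L + ⟦ b ⟧) (P-per (s + 0)) ⟩
        count Pₛ L + ⟦ Pₛ 0 ⟧           ≡⟨ +-comm (count Pₛ L) _ ⟩
        ⟦ Pₛ 0 ⟧ + count Pₛ L           ∎) ⟩
    count Pₛ L                      ≡⟨ count-rotate P L P-per s ⟩
    count P L                       ∎
    where
    open ≡-Reasoning
    Pₛ : ℕ → Bool
    Pₛ k = P (s + k)

  count-linear : ∀ P L .{{_ : NonZero L}} → Periodic P L → ∀ X →
                 L * count P X ≤ X * count P L + L * L × X * count P L ≤ L * count P X + L * L
  count-linear P L P-per X = upper , lower
    where
    open ≤-Reasoning
    q r c : ℕ
    q = X / L
    r = X % L
    c = count P L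
    X≡ : X ≡ q * L + r
    X≡ = trans (ℕ.m≡m%n+[m/n]*n X L) (+-comm r (q * L))
    countX : count P X ≡ q * c + count P r
    countX = trans (cong (count P) X≡) (count-periodic P L P-per q r)
    r≤L : r ≤ L
    r≤L = <⇒≤ (ℕ.m%n<n X L)
    upper : L * count P X ≤ X * c + L * L
    upper = begin
      L * count P X                 ≡⟨ cong (L *_) countX ⟩
      L * (q * c + count P r)       ≡⟨ solve 4 (λ L q c d → L :* (q :* c :+ d) := q :* L :* c :+ L :* d) refl L q c (count P r) ⟩
      q * L * c + L * count P r     ≤⟨ +-mono-≤ (m≤m+n (q * L * c) (r * c)) (*-monoʳ-≤ L (≤-trans (count-≤ P r) r≤L)) ⟩
      (q * L * c + r * c) + L * L   ≡⟨ cong (_+ L * L) (trans (sym (*-distribʳ-+ c (q * L) r)) (cong (_* c) (sym X≡))) ⟩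
      X * c + L * L                 ∎
    lower : X * c ≤ L * count P X + L * L
    lower = begin
      X * c                         ≡⟨ trans (cong (_* c) X≡) (*-distribʳ-+ c (q * L) r) ⟩
      q * L * c + r * c             ≤⟨ +-mono-≤ (m≤m+n (q * L * c) (L * count P r)) (*-mono-≤ r≤L (count-≤ P L)) ⟩
      (q * L * c + L * count P r) + L * L ≡⟨ cong (_+ L * L) (solve 4 (λ L q c d → q :* L :* c :+ L :* d := L :* (q :* c :+ d)) refl L q c (count P r)) ⟩
      L * (q * c + count P r) + L * L ≡⟨ cong (λ n → L * n + L * L) (sym countX) ⟩
      L * count P X + L * L         ∎

  count-none : ∀ n → (∀ k → k < n → P k ≡ false) → count P n ≡ 0
  count-none zero _ = refl
  count-none (suc n) P≡false = cong₂ _+_ (count-none n (λ k k<n → P≡false k (m≤n⇒m≤1+n k<n))) (cong ⟦_⟧ (P≡false n ≤-refl))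

  count-all : ∀ n → (∀ k → k < n → T (P k)) → count P n ≡ n
  count-all zero _ = refl
  count-all {P} (suc n) all-P = trans (cong₂ _+_ (count-all n (λ k k<n → all-P k (m≤n⇒m≤1+n k<n))) (⟦T⟧ (all-P n ≤-refl))) (+-comm n 1)
    where
    ⟦T⟧ : ∀ {b} → T b → ⟦ b ⟧ ≡ 1
    ⟦T⟧ {true} _ = refl

module Sieve where

  open import Data.Bool using (Bool; true; false; T; not; _∧_; _∨_)
  import Data.Bool.Properties as Bool
  open import Data.Bool.ListAction using (any)
  open import Data.Nat as ℕ using (ℕ; suc; _+_; _*_; _∸_; _≤_; _<_; z≤n; s≤s; _%_; _≡ᵇ_)
  open import Data.Nat.Properties
  import Data.Nat.DivMod as ℕ
  open import Data.Nat.Divisibility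
  open import Data.Nat.ListAction using (sum; product)
  open import Data.Nat.ListAction.Properties using (∈⇒∣product)
  open import Data.Nat.Solver using (module +-*-Solver)
  open import Data.Fin using (Fin; toℕ; fromℕ<)
  open import Data.Fin.Properties using (toℕ-fromℕ<; all?)
  open import Data.List using (List; []; _∷_; map; upTo; length)
  open import Data.List.Membership.Propositional using (_∈_; find)
  open import Data.List.Membership.Propositional.Properties using (∈-map⁺; ∈-map⁻; ∈-upTo⁺; ∈-upTo⁻)
  open import Data.List.Relation.Unary.Any using (here; there)
  open import Data.List.Relation.Unary.All using (All; []; _∷_)
  import Data.List.Relation.Unary.All as All
  import Data.List.Relation.Unary.Any as Any
  open import Data.List.Relation.Unary.Any.Properties using (any⁺; any⁻)
  open import Data.Product using (_×_; _,_; ∃-syntax)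
  open import Data.Sum using (inj₁; inj₂)
  open import Data.Empty using (⊥-elim)
  open import Function using (_∘_)
  open import Relation.Nullary using (¬_; yes; no)
  open import Relation.Nullary.Decidable using (⌊_⌋; toWitness; fromWitness; from-yes; isYes≗does; dec-true; dec-false)
  open import Relation.Binary.PropositionalEquality
  open Parity using (ℕ-parity)
  open import Defs using (squareFreeᵇ)
  open Counting
  open +-*-Solver using (solve; _:+_; _:*_; _:=_; con)

  _∣ᵇ_ : ℕ → ℕ → Bool
  m ∣ᵇ n = ⌊ m ∣? n ⌋

  ∣ᵇ-true : ∀ {m n} → m ∣ n → m ∣ᵇ n ≡ true
  ∣ᵇ-true {m} {n} m∣n = trans (isYes≗does (m ∣? n)) (dec-true (m ∣? n) m∣n)

  ∣ᵇ-false : ∀ {m n} → ¬ m ∣ n → m ∣ᵇ n ≡ false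
  ∣ᵇ-false {m} {n} m∤n = trans (isYes≗does (m ∣? n)) (dec-false (m ∣? n) m∤n)

  avoids : List ℕ → ℕ → Bool
  avoids ds n = not (any (λ d → (d * d) ∣ᵇ n) ds)

  T-not⁺ : ∀ {b} → ¬ T b → T (not b)
  T-not⁺ {false} _ = _
  T-not⁺ {true} ¬t = ⊥-elim (¬t _)

  T-not⁻ : ∀ {b} → T (not b) → ¬ T b
  T-not⁻ {false} _ ()

  T-stable : ∀ {b} → ¬ ¬ T b → T b
  T-stable {true} _ = _
  T-stable {false} ¬¬t = ⊥-elim (¬¬t (λ ()))

  avoids-elim : ∀ {ds n d} → T (avoids ds n) → d ∈ ds → ¬ (d * d ∣ n)
  avoids-elim {ds} {n} avoids-n d∈ d²∣n =
    T-not⁻ avoids-n (any⁺ (λ d → (d * d) ∣ᵇ n) (Any.map (λ { refl → fromWitness d²∣n }) d∈))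

  avoids-witness : ∀ ds n → ¬ T (avoids ds n) → ∃[ d ] d ∈ ds × d * d ∣ n
  avoids-witness ds n ¬avoids with find (any⁻ (λ d → (d * d) ∣ᵇ n) ds (T-stable (¬avoids ∘ T-not⁺)))
  ... | d , d∈ , d²∣ᵇn = d , d∈ , toWitness d²∣ᵇn

  ∣ᵇ-shift : ∀ {m M} n → m ∣ M → m ∣ᵇ (M + n) ≡ m ∣ᵇ n
  ∣ᵇ-shift {m} {M} n m∣M with m ∣? (M + n) | m ∣? n
  ... | yes _ | yes _ = refl
  ... | no _  | no _  = refl
  ... | yes m∣M+n | no m∤n = ⊥-elim (m∤n (∣m+n∣m⇒∣n m∣M+n m∣M))
  ... | no m∤M+n | yes m∣n = ⊥-elim (m∤M+n (∣m∣n⇒∣m+n m∣M m∣n))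

  avoids-periodic : ∀ ds {M} → (∀ {d} → d ∈ ds → d * d ∣ M) → ∀ n → avoids ds (M + n) ≡ avoids ds n
  avoids-periodic ds {M} ds∣M n = cong not (any-cong ds ds∣M)
    where
    any-cong : ∀ es → (∀ {d} → d ∈ es → d * d ∣ M) → any (λ d → (d * d) ∣ᵇ (M + n)) es ≡ any (λ d → (d * d) ∣ᵇ n) es
    any-cong [] _ = refl
    any-cong (e ∷ es) es∣M = cong₂ _∨_ (∣ᵇ-shift n (es∣M (here refl))) (any-cong es (es∣M ∘ there))

  squareFree-elim : ∀ {n d} → 1 ≤ n → T (squareFreeᵇ n) → 2 ≤ d → ¬ (d * d ∣ n)
  squareFree-elim {n@(suc _)} {d@(suc (suc i))} _ sf (s≤s (s≤s z≤n)) d²∣n =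
    avoids-elim {map (2 +_) (upTo (n ∸ 1))} sf (∈-map⁺ (2 +_) (∈-upTo⁺ (∸-monoˡ-≤ 1 (≤-trans (m≤m*n d d) (∣⇒≤ d²∣n))))) d²∣n

  squareFree-witness : ∀ n → ¬ T (squareFreeᵇ n) → ∃[ d ] 2 ≤ d × d ≤ n × d * d ∣ n
  squareFree-witness n ¬sf with avoids-witness (map (2 +_) (upTo (n ∸ 1))) n ¬sf
  ... | d , d∈ , d²∣n with ∈-map⁻ (2 +_) d∈
  ...   | i , i∈ , refl = d , s≤s (s≤s z≤n) , bound n i∈ , d²∣n
    where
    bound : ∀ n → i ∈ upTo (n ∸ 1) → 2 + i ≤ n
    bound (suc n) i∈ = s≤s (∈-upTo⁻ i∈)

  below : ∀ {n} {P : ℕ → Set} → (∀ (i : Fin n) → P (toℕ i)) → ∀ a → a < n → P a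
  below {P = P} P-fin a a<n = subst P (toℕ-fromℕ< a<n) (P-fin (fromℕ< a<n))

  ≡1-mod-8 : ∀ {m} q → m ≡ 1 + q * 8 → m % 8 ≡ 1
  ≡1-mod-8 q refl = ℕ.[m+kn]%n≡m%n 1 q 8

  *-≡1-mod-8 : ∀ m n → m % 8 ≡ 1 → n % 8 ≡ 1 → (m * n) % 8 ≡ 1
  *-≡1-mod-8 m n m≡1 n≡1 = trans (ℕ.%-distribˡ-* m n 8) (cong₂ (λ a b → (a * b) % 8) m≡1 n≡1)

  odd-square-mod-8 : ∀ i → (3 + 2 * i) * (3 + 2 * i) % 8 ≡ 1
  odd-square-mod-8 i with ℕ-parity i
  ... | inj₁ (m , refl) = ≡1-mod-8 (1 + 3 * m + 2 * (m * m))
          (solve 1 (λ m → (con 3 :+ con 2 :* (con 2 :* m)) :* (con 3 :+ con 2 :* (con 2 :* m))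
                       := con 1 :+ (con 1 :+ con 3 :* m :+ con 2 :* (m :* m)) :* con 8) refl m)
  ... | inj₂ (m , refl) = ≡1-mod-8 (3 + 5 * m + 2 * (m * m))
          (solve 1 (λ m → (con 3 :+ con 2 :* (con 1 :+ con 2 :* m)) :* (con 3 :+ con 2 :* (con 1 :+ con 2 :* m))
                       := con 1 :+ (con 3 :+ con 5 :* m :+ con 2 :* (m :* m)) :* con 8) refl m)

  sieveDivisors : ℕ → List ℕ
  sieveDivisors K = map (λ i → 3 + 2 * i) (upTo K)

  sieve : ℕ → ℕ → Bool
  sieve K = avoids (sieveDivisors K)

  sieveModulus : ℕ → ℕ
  sieveModulus K = product (map (λ d → d * d) (sieveDivisors K))

  sieveModulus-mod-8 : ∀ K → sieveModulus K % 8 ≡ 1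
  sieveModulus-mod-8 K = go (upTo K)
    where
    go : ∀ is → product (map (λ d → d * d) (map (λ i → 3 + 2 * i) is)) % 8 ≡ 1
    go [] = refl
    go (i ∷ is) = *-≡1-mod-8 ((3 + 2 * i) * (3 + 2 * i)) (product (map (λ d → d * d) (map (λ i → 3 + 2 * i) is))) (odd-square-mod-8 i) (go is)

  sieve-periodic : ∀ K j n → sieve K (sieveModulus K * j + n) ≡ sieve K n
  sieve-periodic K j = avoids-periodic (sieveDivisors K) (λ d∈ → ∣m⇒∣m*n j (∈⇒∣product (∈-map⁺ (λ d → d * d) d∈)))

  squareFree⇒sieve : ∀ K {n} → 1 ≤ n → T (squareFreeᵇ n) → T (sieve K n)
  squareFree⇒sieve K {n} 1≤n sf = T-stable λ ¬sieve →
    let d , d∈ , d²∣n = avoids-witness (sieveDivisors K) n ¬sieve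
        i , _ , d≡ = ∈-map⁻ (λ i → 3 + 2 * i) d∈
    in squareFree-elim 1≤n sf (subst (2 ≤_) (sym d≡) (s≤s (s≤s z≤n))) d²∣n

  module Residues (K : ℕ) where

    M L : ℕ
    M = sieveModulus K
    L = 8 * M

    instance
      L-nonZero : ℕ.NonZero L
      L-nonZero = m*n≢0 8 M {{_}} {{ℕ.≢-nonZero (λ M≡0 → 0≢1+n (trans (sym (cong (_% 8) M≡0)) (sieveModulus-mod-8 K)))}}

    class : ℕ → ℕ → Bool
    class a n = sieve K n ∧ (n % 8 ≡ᵇ a)

    fourFree : ℕ → Bool
    fourFree n = sieve K n ∧ not (n % 4 ≡ᵇ 0)

    sieve-L-periodic : Periodic (sieve K) L
    sieve-L-periodic n = trans (cong (λ m → sieve K (m + n)) (*-comm 8 M)) (sieve-periodic K 8 n)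

    class-periodic : ∀ a → Periodic (class a) L
    class-periodic a n = cong₂ _∧_ (sieve-L-periodic n) (cong (_≡ᵇ a) (ℕ.%-remove-+ˡ n (divides M (*-comm 8 M))))

    fourFree-periodic : Periodic fourFree L
    fourFree-periodic n = cong₂ _∧_ (sieve-L-periodic n)
      (cong (λ r → not (r ≡ᵇ 0)) (ℕ.%-remove-+ˡ n (divides (2 * M) (solve 1 (λ M → con 8 :* M := con 2 :* M :* con 4) refl M))))

    C : ℕ
    C = count (class 1) L

    shift-table : ∀ (i j : Fin 8) → (((1 * ((9 ∸ toℕ i) % 8)) % 8 + toℕ j) % 8 ≡ᵇ 1) ≡ (toℕ j ≡ᵇ toℕ i)
    shift-table = from-yes (all? {8} λ i → all? {8} λ j → (((1 * ((9 ∸ toℕ i) % 8)) % 8 + toℕ j) % 8 ≡ᵇ 1) Bool.≟ (toℕ j ≡ᵇ toℕ i))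

    -- M ≡ 1 (mod 8): shifting by M(9 − a) keeps the sieve and moves residue a to residue 1.
    class-shift : ∀ a → a < 8 → ∀ n → class 1 (M * (9 ∸ a) + n) ≡ class a n
    class-shift a a<8 n = cong₂ _∧_ (sieve-periodic K (9 ∸ a) n) (begin
      (M * (9 ∸ a) + n) % 8 ≡ᵇ 1                               ≡⟨ cong (_≡ᵇ 1) (ℕ.%-distribˡ-+ (M * (9 ∸ a)) n 8) ⟩
      ((M * (9 ∸ a)) % 8 + n % 8) % 8 ≡ᵇ 1                     ≡⟨ cong (λ r → (r + n % 8) % 8 ≡ᵇ 1) (ℕ.%-distribˡ-* M (9 ∸ a) 8) ⟩
      ((M % 8 * ((9 ∸ a) % 8)) % 8 + n % 8) % 8 ≡ᵇ 1           ≡⟨ cong (λ m → ((m * ((9 ∸ a) % 8)) % 8 + n % 8) % 8 ≡ᵇ 1) (sieveModulus-mod-8 K) ⟩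
      ((1 * ((9 ∸ a) % 8)) % 8 + n % 8) % 8 ≡ᵇ 1               ≡⟨ below {P = λ a → ∀ b → b < 8 → (((1 * ((9 ∸ a) % 8)) % 8 + b) % 8 ≡ᵇ 1) ≡ (b ≡ᵇ a)}
                                                                     (λ i → below (shift-table i)) a a<8 (n % 8) (ℕ.m%n<n n 8) ⟩
      n % 8 ≡ᵇ a                                               ∎)
      where open ≡-Reasoning

    count-class : ∀ a → a < 8 → count (class a) L ≡ C
    count-class a a<8 = begin
      count (class a) L                          ≡⟨ count-cong L (λ k _ → sym (class-shift a a<8 k)) ⟩
      count (λ k → class 1 (M * (9 ∸ a) + k)) L  ≡⟨ count-rotate (class 1) L (class-periodic 1) (M * (9 ∸ a)) ⟩
      C                                          ∎
      where open ≡-Reasoning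

    residues : List ℕ
    residues = 1 ∷ 2 ∷ 3 ∷ 5 ∷ 6 ∷ 7 ∷ []

    fourFree-split : ∀ n → ⟦ fourFree n ⟧ ≡ sum (map (λ Q → ⟦ Q n ⟧) (map class residues))
    fourFree-split n = trans (cong (λ r → ⟦ sieve K n ∧ not (r ≡ᵇ 0) ⟧) (sym (ℕ.m∣n⇒o%n%m≡o%m 4 8 n (divides 2 refl))))
                             (split (sieve K n) (n % 8) (ℕ.m%n<n n 8))
      where
      table : ∀ (i : Fin 8) → ⟦ not (toℕ i % 4 ≡ᵇ 0) ⟧ ≡ sum (map (λ a → ⟦ toℕ i ≡ᵇ a ⟧) residues)
      table = from-yes (all? {8} λ i → ⟦ not (toℕ i % 4 ≡ᵇ 0) ⟧ ℕ.≟ sum (map (λ a → ⟦ toℕ i ≡ᵇ a ⟧) residues))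
      split : ∀ g b → b < 8 → ⟦ g ∧ not (b % 4 ≡ᵇ 0) ⟧ ≡ sum (map (λ a → ⟦ g ∧ (b ≡ᵇ a) ⟧) residues)
      split false b _ = refl
      split true = below table

    count-fourFree : count fourFree L ≡ 6 * C
    count-fourFree = trans (count-Σ fourFree (map class residues) L fourFree-split) (Σ-classes residues (from-yes (All.all? (_<? 8) residues)))
      where
      Σ-classes : ∀ as → All (_< 8) as → sum (map (λ Q → count Q L) (map class as)) ≡ length as * C
      Σ-classes [] [] = refl
      Σ-classes (a ∷ as) (a<8 ∷ as<8) = cong₂ _+_ (count-class a a<8) (Σ-classes as as<8)

module Tail where

  open import Data.Bool using (Bool)
  open import Data.Bool.ListAction using (any)
  open import Data.Nat as ℕ using (ℕ; zero; suc; _+_; _*_; _≤_; _<_; s≤s; _/_; _%_; NonZero)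
  open import Data.Nat.Properties
  import Data.Nat.DivMod as ℕ
  open import Data.Nat.Divisibility
  open import Data.Nat.ListAction using (sum)
  open import Data.Nat.Solver using (module +-*-Solver)
  open import Data.List using (List; []; _∷_; map; applyUpTo)
  open import Data.List.Properties using (map-applyUpTo)
  open import Function using (_∘_)
  open import Relation.Binary.PropositionalEquality
  open Counting
  open Sieve using (_∣ᵇ_; ∣ᵇ-shift; ∣ᵇ-true; ∣ᵇ-false)
  open +-*-Solver using (solve; _:+_; _:*_; _:=_; con)

  count-multiples : ∀ m .{{_ : NonZero m}} X → count (λ n → m ∣ᵇ suc n) X ≡ X / m
  count-multiples m@(suc m-1) X = begin
    count P X                       ≡⟨ cong (count P) X≡ ⟩
    count P (X / m * m + X % m)     ≡⟨ count-periodic P m P-periodic (X / m) (X % m) ⟩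
    X / m * count P m + count P (X % m) ≡⟨ cong₂ (λ a b → X / m * a + b) count-period (count-below (X % m) (ℕ.m%n<n X m)) ⟩
    X / m * 1 + 0                   ≡⟨ trans (+-identityʳ (X / m * 1)) (*-identityʳ (X / m)) ⟩
    X / m                           ∎
    where
    open ≡-Reasoning
    P : ℕ → Bool
    P n = m ∣ᵇ suc n
    X≡ : X ≡ X / m * m + X % m
    X≡ = trans (ℕ.m≡m%n+[m/n]*n X m) (+-comm (X % m) (X / m * m))
    P-periodic : Periodic P m
    P-periodic k = trans (cong (m ∣ᵇ_) (sym (+-suc m k))) (∣ᵇ-shift (suc k) ∣-refl)
    count-below : ∀ r → r < m → count P r ≡ 0
    count-below r r<m = count-none r λ k k<r →
      ∣ᵇ-false (λ m∣k+1 → <⇒≱ (≤-trans (s≤s k<r) r<m) (∣⇒≤ m∣k+1))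
    count-period : count P m ≡ 1
    count-period = cong₂ _+_ (count-below m-1 ≤-refl) (cong ⟦_⟧ (∣ᵇ-true ∣-refl))

  tailDivisors : ℕ → ℕ → List ℕ
  tailDivisors p X = applyUpTo (λ i → 2 + p + i) X

  tail : ℕ → ℕ → ℕ → Bool
  tail p X n = any (λ d → (d * d) ∣ᵇ suc n) (tailDivisors p X)

  count-any : ∀ (Q : ℕ → ℕ → Bool) ds X → count (λ n → any (Q n) ds) X ≤ sum (map (λ d → count (λ n → Q n d) X) ds)
  count-any Q [] X = ≤-reflexive (count-none X (λ _ _ → refl))
  count-any Q (d ∷ ds) X = ≤-trans (count-∨ (λ n → Q n d) (λ n → any (Q n) ds) X)
                                   (+-monoʳ-≤ (count (λ n → Q n d) X) (count-any Q ds X))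

  *≤⇒≤/ : ∀ a b Y .{{_ : NonZero b}} → a * b ≤ Y → a ≤ Y / b
  *≤⇒≤/ a b Y ab≤Y = subst (_≤ Y / b) (ℕ.m*n/n≡m a b) (ℕ./-monoˡ-≤ b ab≤Y)

  -- 1/(m+1)² ≤ 1/m − 1/(m+1), here with m = e + 1
  telescope-step : ∀ Y e → Y / (suc (suc e) * suc (suc e)) + Y / suc (suc e) ≤ Y / suc e
  telescope-step Y e = *≤⇒≤/ (q + s) (suc e) Y (begin
    (q + s) * suc e        ≡⟨ *-distribʳ-+ (suc e) q s ⟩
    q * suc e + s * suc e  ≤⟨ +-monoˡ-≤ (s * suc e) (≤-trans (*-monoʳ-≤ q (n≤1+n (suc e))) q[e+2]≤s) ⟩
    s + s * suc e          ≡⟨ solve 2 (λ s e → s :+ s :* e := s :* (con 1 :+ e)) refl s (suc e) ⟩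
    s * suc (suc e)        ≤⟨ ℕ.m/n*n≤m Y (suc (suc e)) ⟩
    Y                      ∎)
    where
    open ≤-Reasoning
    q s : ℕ
    q = Y / (suc (suc e) * suc (suc e))
    s = Y / suc (suc e)
    q[e+2]≤s : q * suc (suc e) ≤ s
    q[e+2]≤s = *≤⇒≤/ (q * suc (suc e)) (suc (suc e)) Y
      (subst (_≤ Y) (sym (*-assoc q (suc (suc e)) (suc (suc e)))) (ℕ.m/n*n≤m Y (suc (suc e) * suc (suc e))))

  applyUpTo-cong : ∀ {f g : ℕ → ℕ} n → (∀ i → f i ≡ g i) → applyUpTo f n ≡ applyUpTo g n
  applyUpTo-cong zero _ = refl
  applyUpTo-cong (suc n) f≗g = cong₂ _∷_ (f≗g 0) (applyUpTo-cong n (f≗g ∘ suc))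

  telescope : ∀ Y p n → sum (applyUpTo (λ i → Y / ((2 + p + i) * (2 + p + i))) n) + Y / suc (p + n) ≤ Y / suc p
  telescope Y p zero = ≤-reflexive (cong (λ m → Y / suc m) (+-identityʳ p))
  telescope Y p (suc n) = begin
    Y / (d * d) + sum (applyUpTo (λ i → Y / ((2 + p + suc i) * (2 + p + suc i))) n) + Y / suc (p + suc n)
      ≡⟨ cong₂ (λ xs m → Y / (d * d) + sum xs + Y / suc m) (applyUpTo-cong n (λ i → cong (λ m → Y / (suc m * suc m)) (+-suc (suc p) i))) (+-suc p n) ⟩
    Y / (d * d) + sum (applyUpTo (λ i → Y / ((2 + suc p + i) * (2 + suc p + i))) n) + Y / suc (suc p + n)
      ≡⟨ +-assoc (Y / (d * d)) _ _ ⟩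
    Y / (d * d) + (sum (applyUpTo (λ i → Y / ((2 + suc p + i) * (2 + suc p + i))) n) + Y / suc (suc p + n))
      ≤⟨ +-monoʳ-≤ (Y / (d * d)) (telescope Y (suc p) n) ⟩
    Y / (d * d) + Y / suc (suc p)
      ≡⟨ cong (λ m → Y / (suc (suc m) * suc (suc m)) + Y / suc (suc p)) (+-identityʳ p) ⟩
    Y / (suc (suc p) * suc (suc p)) + Y / suc (suc p)
      ≤⟨ telescope-step Y p ⟩
    Y / suc p ∎
    where
    open ≤-Reasoning
    d : ℕ
    d = 2 + p + 0

  count-tail : ∀ p X → count (tail p X) X ≤ X / suc p
  count-tail p X = begin
    count (tail p X) X
      ≤⟨ count-any (λ n d → (d * d) ∣ᵇ suc n) (tailDivisors p X) X ⟩
    sum (map (λ d → count (λ n → (d * d) ∣ᵇ suc n) X) (tailDivisors p X))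
      ≡⟨ cong sum (map-applyUpTo (λ i → 2 + p + i) (λ d → count (λ n → (d * d) ∣ᵇ suc n) X) X) ⟩
    sum (applyUpTo (λ i → count (λ n → ((2 + p + i) * (2 + p + i)) ∣ᵇ suc n) X) X)
      ≡⟨ cong sum (applyUpTo-cong X (λ i → count-multiples ((2 + p + i) * (2 + p + i)) X)) ⟩
    sum (applyUpTo (λ i → X / ((2 + p + i) * (2 + p + i))) X)
      ≤⟨ m≤m+n _ (X / suc (p + X)) ⟩
    sum (applyUpTo (λ i → X / ((2 + p + i) * (2 + p + i))) X) + X / suc (p + X)
      ≤⟨ telescope X p X ⟩
    X / suc p ∎
    where open ≤-Reasoning

module Comparison where

  open import Data.Bool using (Bool; true; T; _∧_; _∨_)
  import Data.Bool.Properties as Bool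
  open import Data.Bool.Properties using (T?)
  open import Data.Nat as ℕ using (ℕ; zero; suc; _+_; _*_; _∸_; _≤_; _<_; z≤n; s≤s; _/_; _%_; _≡ᵇ_; ∣_-_∣)
  open import Data.Nat.Properties
  import Data.Nat.DivMod as ℕ
  open import Data.Nat.Divisibility
  open import Data.Nat.Solver using (module +-*-Solver)
  open import Data.List.Membership.Propositional using (_∈_)
  open import Data.List.Membership.Propositional.Properties using (∈-map⁺; ∈-upTo⁺; ∈-applyUpTo⁺)
  import Data.List.Relation.Unary.Any as Any
  open import Data.List.Relation.Unary.Any.Properties using (any⁺)
  open import Data.Product using (_×_; _,_; proj₁; proj₂)
  open import Data.Sum using (inj₁; inj₂)
  open import Data.Empty using (⊥-elim)
  open import Function using (_∘_)
  open import Function.Bundles using (Equivalence)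
  open import Relation.Nullary using (¬_; yes; no)
  open import Relation.Nullary.Decidable using (fromWitness)
  open import Relation.Binary.PropositionalEquality
  open Parity using (ℕ-parity)
  open import Defs using (squareFreeᵇ; inUᵇ; inNsfᵇ)
  open Counting
  open Sieve
  open Tail
  open +-*-Solver using (solve; _:+_; _:*_; _:=_; con)

  private
    ∧-intro : ∀ {a b} → T a → T b → T (a ∧ b)
    ∧-intro = λ ta tb → Equivalence.from Bool.T-∧ (ta , tb)

    ∧-fst : ∀ {a b} → T (a ∧ b) → T a
    ∧-fst {true} _ = _

    ∧-snd : ∀ {a b} → T (a ∧ b) → T b
    ∧-snd {true} t = t

    ∨-inj₁ : ∀ {a b} → T a → T (a ∨ b)
    ∨-inj₁ t = Equivalence.from Bool.T-∨ (inj₁ t)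

    ∨-inj₂ : ∀ {a b} → T b → T (a ∨ b)
    ∨-inj₂ t = Equivalence.from Bool.T-∨ (inj₂ t)

    4∣⇒%4≡0 : ∀ {m} → 4 ∣ m → m % 4 ≡ 0
    4∣⇒%4≡0 {m} = n∣m⇒m%n≡0 m 4

    %8≡1⇒4∤ : ∀ {m} → m % 8 ≡ 1 → ¬ (4 ∣ m)
    %8≡1⇒4∤ {m} m%8≡1 4∣m = 0≢1+n (trans (sym (4∣⇒%4≡0 4∣m)) (trans (sym (ℕ.m∣n⇒o%n%m≡o%m 4 8 m (divides 2 refl))) (cong (_% 4) m%8≡1)))

    squareFree⇒4∤ : ∀ {m} → 1 ≤ m → T (squareFreeᵇ m) → ¬ (4 ∣ m)
    squareFree⇒4∤ {m} 1≤m sf = squareFree-elim {m} {2} 1≤m sf (s≤s (s≤s z≤n))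

    T-≡ᵇ : ∀ {m n} → T (m ≡ᵇ n) → m ≡ n
    T-≡ᵇ {m} {n} = ≡ᵇ⇒≡ m n

    ≡-T-≡ᵇ : ∀ {m n} → m ≡ n → T (m ≡ᵇ n)
    ≡-T-≡ᵇ {m} {n} = ≡⇒≡ᵇ m n

  module Exceptions (K X : ℕ) where

    exceptional : ℕ → Bool
    exceptional n = (n ≡ᵇ 0) ∨ tail (1 + 2 * K) X n

    -- a square divisor d² of n + 1 is either even (then 4 ∣ n + 1), an odd d ≤ 2K + 1 caught by
    -- the sieve, or an odd d ≥ 2K + 3, recorded by the tail
    sieved-nonSquareFree : ∀ n → n < X → T (sieve K (suc n)) → ¬ (4 ∣ suc n) → ¬ T (squareFreeᵇ (suc n)) →
                           T (exceptional n)
    sieved-nonSquareFree n n<X sieved 4∤ ¬sf with squareFree-witness (suc n) ¬sf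
    ... | d , 2≤d , d≤n+1 , d²∣n+1 with ℕ-parity d
    ...   | inj₁ (k , refl) = ⊥-elim (4∤ (∣-trans (divides (k * k) (solve 1 (λ k → (con 2 :* k) :* (con 2 :* k) := k :* k :* con 4) refl k)) d²∣n+1))
    ...   | inj₂ (zero , refl) = ⊥-elim (<⇒≱ 2≤d ≤-refl)
    ...   | inj₂ (suc i , refl) with i <? K
    ...     | yes i<K = ⊥-elim (avoids-elim sieved (∈-map⁺ (λ i → 3 + 2 * i) (∈-upTo⁺ i<K)) (subst (λ d → d * d ∣ suc n) d≡ d²∣n+1))
      where
      d≡ : suc (2 * suc i) ≡ 3 + 2 * i
      d≡ = solve 1 (λ i → con 1 :+ con 2 :* (con 1 :+ i) := con 3 :+ con 2 :* i) refl i
    ...     | no i≮K = ∨-inj₂ (any⁺ (λ d → (d * d) ∣ᵇ suc n) (Any.map (λ { refl → fromWitness d²∣n+1 }) d∈))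
      where
      j : ℕ
      j = 2 * i ∸ 2 * K
      d≡ : 2 + (1 + 2 * K) + j ≡ suc (2 * suc i)
      d≡ = trans (cong (3 +_) (m+[n∸m]≡n (*-monoʳ-≤ 2 (≮⇒≥ i≮K)))) (solve 1 (λ i → con 3 :+ con 2 :* i := con 1 :+ con 2 :* (con 1 :+ i)) refl i)
      j<X : j < X
      j<X = <-≤-trans (m<n+m j (s≤s z≤n)) (subst (_≤ X) (sym d≡) (≤-trans d≤n+1 n<X))
      d∈ : suc (2 * suc i) ∈ tailDivisors (1 + 2 * K) X
      d∈ = subst (_∈ tailDivisors (1 + 2 * K) X) d≡ (∈-applyUpTo⁺ (λ j → 2 + (1 + 2 * K) + j) j<X)

    open Residues K

    inU⇒class : ∀ n → T (inUᵇ (suc n)) → T (class 1 (suc n))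
    inU⇒class (suc n) t = ∧-intro (squareFree⇒sieve K (s≤s z≤n) (∧-fst t)) (∧-snd {squareFreeᵇ (2 + n)} t)

    inNsf⇒fourFree : ∀ n → T (inNsfᵇ (suc n)) → T (fourFree (suc n))
    inNsf⇒fourFree (suc n) sf = ∧-intro (squareFree⇒sieve K (s≤s z≤n) sf)
      (T-not⁺ (λ m%4≡0 → squareFree⇒4∤ (s≤s z≤n) sf (m%n≡0⇒n∣m (2 + n) 4 (T-≡ᵇ m%4≡0))))

    class⇒inU : ∀ n → n < X → T (class 1 (suc n)) → T (inUᵇ (suc n) ∨ exceptional n)
    class⇒inU zero _ _ = _
    class⇒inU (suc n) n<X t with T? (squareFreeᵇ (2 + n))
    ... | yes sf  = ∨-inj₁ (∧-intro sf (∧-snd {sieve K (2 + n)} t))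
    ... | no ¬sf = ∨-inj₂ {inUᵇ (2 + n)} (sieved-nonSquareFree (suc n) n<X (∧-fst t) (%8≡1⇒4∤ (T-≡ᵇ (∧-snd {sieve K (2 + n)} t))) ¬sf)

    fourFree⇒inNsf : ∀ n → n < X → T (fourFree (suc n)) → T (inNsfᵇ (suc n) ∨ exceptional n)
    fourFree⇒inNsf zero _ _ = _
    fourFree⇒inNsf (suc n) n<X t with T? (squareFreeᵇ (2 + n))
    ... | yes sf  = ∨-inj₁ sf
    ... | no ¬sf = ∨-inj₂ {inNsfᵇ (2 + n)} (sieved-nonSquareFree (suc n) n<X (∧-fst t)
                       (λ 4∣ → T-not⁻ (∧-snd {sieve K (2 + n)} t) (≡-T-≡ᵇ (4∣⇒%4≡0 4∣))) ¬sf)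

    count-exceptional : count exceptional X ≤ 1 + X / (2 + 2 * K)
    count-exceptional = ≤-trans (count-∨ (_≡ᵇ 0) (tail (1 + 2 * K) X) X) (+-mono-≤ (count-zero X) (count-tail (1 + 2 * K) X))
      where
      count-zero : ∀ X → count (_≡ᵇ 0) X ≤ 1
      count-zero zero = z≤n
      count-zero (suc X) = ≤-reflexive (trans (count-suc (_≡ᵇ 0) X) (cong suc (count-none X (λ _ _ → refl))))

  proportional-counts : ∀ {L X a b c} k → 0 < L →
                        L * a ≤ X * c + L * L → X * c ≤ L * a + L * L →
                        L * b ≤ X * (k * c) + L * L → X * (k * c) ≤ L * b + L * L →
                        k * a ≤ b + suc k * L × b ≤ k * a + suc k * L
  proportional-counts {L} {X} {a} {b} {c} k 0<L La≤ Xc≤ Lb≤ Xkc≤ = *-cancelˡ-≤ L ka≤ , *-cancelˡ-≤ L b≤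
    where
    open ≤-Reasoning
    instance
      L-nonZero : ℕ.NonZero L
      L-nonZero = ℕ.>-nonZero 0<L
    ka≤ : L * (k * a) ≤ L * (b + suc k * L)
    ka≤ = begin
      L * (k * a)                   ≡⟨ solve 3 (λ L k a → L :* (k :* a) := k :* (L :* a)) refl L k a ⟩
      k * (L * a)                   ≤⟨ *-monoʳ-≤ k La≤ ⟩
      k * (X * c + L * L)           ≡⟨ solve 4 (λ k X c L → k :* (X :* c :+ L :* L) := X :* (k :* c) :+ k :* (L :* L)) refl k X c L ⟩
      X * (k * c) + k * (L * L)     ≤⟨ +-monoˡ-≤ (k * (L * L)) Xkc≤ ⟩
      L * b + L * L + k * (L * L)   ≡⟨ solve 3 (λ L b k → L :* b :+ L :* L :+ k :* (L :* L) := L :* (b :+ (con 1 :+ k) :* L)) refl L b k ⟩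
      L * (b + suc k * L)           ∎
    b≤ : L * b ≤ L * (k * a + suc k * L)
    b≤ = begin
      L * b                         ≤⟨ Lb≤ ⟩
      X * (k * c) + L * L           ≡⟨ cong (_+ L * L) (solve 3 (λ X k c → X :* (k :* c) := k :* (X :* c)) refl X k c) ⟩
      k * (X * c) + L * L           ≤⟨ +-monoˡ-≤ (L * L) (*-monoʳ-≤ k Xc≤) ⟩
      k * (L * a + L * L) + L * L   ≡⟨ solve 3 (λ k L a → k :* (L :* a :+ L :* L) :+ L :* L := L :* (k :* a :+ (con 1 :+ k) :* L)) refl k L a ⟩
      L * (k * a + suc k * L)       ∎

  ∣-∣≤ : ∀ {m n o} → m ≤ n + o → n ≤ m + o → ∣ m - n ∣ ≤ o
  ∣-∣≤ {m} {n} {o} m≤ n≤ with ∣m-n∣≡[m∸n]∨[n∸m] m n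
  ... | inj₁ eq = subst (_≤ o) (sym eq) (m≤n+o⇒m∸n≤o m n m≤)
  ... | inj₂ eq = subst (_≤ o) (sym eq) (m≤n+o⇒m∸n≤o n m n≤)

  -- Indices n < X stand for m = n + 1 ∈ [1, X]; countUpTo also counts m = 0, which lies in neither set.
  module Deviation (K X : ℕ) where

    open Residues K
    open Exceptions K X

    U N SU SN E : ℕ
    U = count (inUᵇ ∘ suc) X
    N = count (inNsfᵇ ∘ suc) X
    SU = count (class 1 ∘ suc) X
    SN = count (fourFree ∘ suc) X
    E = count exceptional X

    sieved-proportional : 6 * SU ≤ SN + 7 * L × SN ≤ 6 * SU + 7 * L
    sieved-proportional = proportional-counts {L} {X} {SU} {SN} {C} 6 (ℕ.>-nonZero⁻¹ L)
      (subst (λ c → L * SU ≤ X * c + L * L) period-SU (proj₁ linear-SU)) (subst (λ c → X * c ≤ L * SU + L * L) period-SU (proj₂ linear-SU))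
      (subst (λ c → L * SN ≤ X * c + L * L) period-SN (proj₁ linear-SN)) (subst (λ c → X * c ≤ L * SN + L * L) period-SN (proj₂ linear-SN))
      where
      period-SU : count (class 1 ∘ suc) L ≡ C
      period-SU = count-rotate (class 1) L (class-periodic 1) 1
      period-SN : count (fourFree ∘ suc) L ≡ 6 * C
      period-SN = trans (count-rotate fourFree L fourFree-periodic 1) count-fourFree
      linear-SU : L * SU ≤ X * count (class 1 ∘ suc) L + L * L × X * count (class 1 ∘ suc) L ≤ L * SU + L * L
      linear-SU = count-linear (class 1 ∘ suc) L (λ k → trans (cong (class 1) (sym (+-suc L k))) (class-periodic 1 (suc k))) X
      linear-SN : L * SN ≤ X * count (fourFree ∘ suc) L + L * L × X * count (fourFree ∘ suc) L ≤ L * SN + L * L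
      linear-SN = count-linear (fourFree ∘ suc) L (λ k → trans (cong fourFree (sym (+-suc L k))) (fourFree-periodic (suc k))) X

    deviation : ∣ U * 6 - N ∣ ≤ 6 * (1 + X / (2 + 2 * K)) + 7 * L
    deviation = ≤-trans (∣-∣≤ U*6≤ N≤) (+-monoˡ-≤ (7 * L) (*-monoʳ-≤ 6 count-exceptional))
      where
      open ≤-Reasoning
      U≤SU : U ≤ SU
      U≤SU = count-mono X (λ n _ → inU⇒class n)
      SU≤U+E : SU ≤ U + E
      SU≤U+E = ≤-trans (count-mono X class⇒inU) (count-∨ (inUᵇ ∘ suc) exceptional X)
      N≤SN : N ≤ SN
      N≤SN = count-mono X (λ n _ → inNsf⇒fourFree n)
      SN≤N+E : SN ≤ N + E
      SN≤N+E = ≤-trans (count-mono X fourFree⇒inNsf) (count-∨ (inNsfᵇ ∘ suc) exceptional X)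
      U*6≤ : U * 6 ≤ N + (6 * E + 7 * L)
      U*6≤ = begin
        U * 6               ≤⟨ *-monoˡ-≤ 6 U≤SU ⟩
        SU * 6              ≡⟨ *-comm SU 6 ⟩
        6 * SU              ≤⟨ proj₁ sieved-proportional ⟩
        SN + 7 * L          ≤⟨ +-monoˡ-≤ (7 * L) SN≤N+E ⟩
        N + E + 7 * L       ≤⟨ +-monoˡ-≤ (7 * L) (+-monoʳ-≤ N (m≤n*m E 6)) ⟩
        N + 6 * E + 7 * L   ≡⟨ +-assoc N (6 * E) (7 * L) ⟩
        N + (6 * E + 7 * L) ∎
      N≤ : N ≤ U * 6 + (6 * E + 7 * L)
      N≤ = begin
        N                         ≤⟨ N≤SN ⟩
        SN                        ≤⟨ proj₂ sieved-proportional ⟩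
        6 * SU + 7 * L            ≤⟨ +-monoˡ-≤ (7 * L) (*-monoʳ-≤ 6 SU≤U+E) ⟩
        6 * (U + E) + 7 * L       ≡⟨ solve 3 (λ U E L → con 6 :* (U :+ E) :+ con 7 :* L := U :* con 6 :+ (con 6 :* E :+ con 7 :* L)) refl U E L ⟩
        U * 6 + (6 * E + 7 * L)   ∎

  -- Each m ≤ X is square-free, divisible by 4, or divisible by d² for some odd d ≥ 3,
  -- so X ≤ (N + 1) + X/4 + X/2.
  squareFree-lower-bound : ∀ X → X ≤ 4 * count (inNsfᵇ ∘ suc) X + 4
  squareFree-lower-bound X = +-cancelʳ-≤ (3 * X) X (4 * N + 4) (begin
    X + 3 * X                                         ≡⟨ solve 1 (λ X → X :+ con 3 :* X := con 4 :* X) refl X ⟩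
    4 * X                                             ≤⟨ *-monoʳ-≤ 4 X≤ ⟩
    4 * (N + (1 + X / 2) + X / 4)                     ≡⟨ solve 3 (λ N h q → con 4 :* (N :+ (con 1 :+ h) :+ q)
                                                             := con 4 :* N :+ con 4 :+ con 2 :* (h :* con 2) :+ q :* con 4) refl N (X / 2) (X / 4) ⟩
    4 * N + 4 + 2 * (X / 2 * 2) + X / 4 * 4           ≤⟨ +-mono-≤ (+-monoʳ-≤ (4 * N + 4) (*-monoʳ-≤ 2 (ℕ.m/n*n≤m X 2))) (ℕ.m/n*n≤m X 4) ⟩
    4 * N + 4 + 2 * X + X                             ≡⟨ solve 2 (λ N X → con 4 :* N :+ con 4 :+ con 2 :* X :+ X := con 4 :* N :+ con 4 :+ con 3 :* X) refl N X ⟩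
    4 * N + 4 + 3 * X                                 ∎)
    where
    open ≤-Reasoning
    open Exceptions 0 X
    N : ℕ
    N = count (inNsfᵇ ∘ suc) X
    covered : ∀ n → n < X → T ((inNsfᵇ (suc n) ∨ exceptional n) ∨ (4 ∣ᵇ suc n))
    covered n n<X with 4 ∣? suc n
    ... | yes _  = ∨-inj₂ {inNsfᵇ (suc n) ∨ exceptional n} _
    ... | no 4∤ = ∨-inj₁ (fourFree⇒inNsf n n<X (T-not⁺ (λ ≡0 → 4∤ (m%n≡0⇒n∣m (suc n) 4 (T-≡ᵇ ≡0)))))
    X≤ : X ≤ N + (1 + X / 2) + X / 4
    X≤ = begin
      X                                               ≡⟨ sym (count-all X covered) ⟩
      count (λ n → (inNsfᵇ (suc n) ∨ exceptional n) ∨ (4 ∣ᵇ suc n)) X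
                                                      ≤⟨ count-∨ (λ n → inNsfᵇ (suc n) ∨ exceptional n) (λ n → 4 ∣ᵇ suc n) X ⟩
      count (λ n → inNsfᵇ (suc n) ∨ exceptional n) X + count (λ n → 4 ∣ᵇ suc n) X
                                                      ≤⟨ +-mono-≤ (count-∨ (inNsfᵇ ∘ suc) exceptional X) (≤-reflexive (count-multiples 4 X)) ⟩
      N + count exceptional X + X / 4                 ≤⟨ +-monoˡ-≤ (X / 4) (+-monoʳ-≤ N count-exceptional) ⟩
      N + (1 + X / 2) + X / 4                         ∎

module Limit where

  open import Data.Nat as ℕ using (ℕ; zero; suc; _+_; _*_; _<_; _/_; ∣_-_∣)
  import Data.Nat.Properties as ℕ
  open import Data.Nat.Solver using (module +-*-Solver)
  open import Data.Integer as ℤ using (ℤ; +_; -[1+_]; +<+)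
  import Data.Integer.Properties as ℤ
  import Data.Integer.Solver as ℤ-Solver
  open import Data.Rational as ℚ using (ℚ; 0ℚ; mkℚ; toℚᵘ; *<*)
  import Data.Rational.Properties as ℚ
  open import Data.Rational.Unnormalised as ℚᵘ using (mkℚᵘ; *≡*)
  import Data.Rational.Unnormalised.Properties as ℚᵘ
  open import Data.Sum using (inj₁; inj₂)
  open import Relation.Binary.PropositionalEquality

  ∣+m-+n∣ : ∀ m n → ℤ.∣ + m ℤ.- + n ∣ ≡ ∣ m - n ∣
  ∣+m-+n∣ m n with ℕ.≤-total m n
  ... | inj₁ m≤n = trans (cong ℤ.∣_∣ (ℤ.m-n≡m⊖n m n)) (trans (ℤ.∣⊖∣-≤ m≤n) (sym (ℕ.m≤n⇒∣m-n∣≡n∸m m≤n)))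
  ... | inj₂ n≤m = trans (cong ℤ.∣_∣ (trans (ℤ.m-n≡m⊖n m n) (ℤ.⊖-≥ n≤m))) (sym (ℕ.m≤n⇒∣n-m∣≡n∸m n≤m))

  close-to-a-sixth : ∀ U N ε → 0ℚ ℚ.< ε → ∣ U * 6 - suc N ∣ * ℚ.↧ₙ ε < suc N * 6 →
                     ℚ.∣ (+ U) ℚ./ suc N ℚ.- (+ 1) ℚ./ 6 ∣ ℚ.< ε
  close-to-a-sixth U N ε@(mkℚ (+ suc a) d-1 _) _ dev<6N = ℚ.toℚᵘ-cancel-< (ℚᵘ.<-respˡ-≃ (ℚᵘ.≃-sym ∣x-y∣≃∣w∣) ∣w∣<ε)
    where
    w : ℚᵘ.ℚᵘ
    w = mkℚᵘ (+ (U * 6) ℤ.- + suc N) (5 + N * 6)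
    x-y≃w : mkℚᵘ (+ U) N ℚᵘ.- mkℚᵘ (+ 1) 5 ℚᵘ.≃ w
    x-y≃w = *≡* (cong (ℤ._* (+ (suc N * 6))) (trans
      (ℤS.solve 2 (λ u n → u ℤS.:* ℤS.con (+ 6) ℤS.:+ (ℤS.:- ℤS.con (+ 1)) ℤS.:* n ℤS.:= u ℤS.:* ℤS.con (+ 6) ℤS.:- n) refl (+ U) (+ suc N))
      (cong (ℤ._- + suc N) (sym (ℤ.pos-* U 6)))))
      where module ℤS = ℤ-Solver.+-*-Solver
    ∣x-y∣≃∣w∣ : toℚᵘ ℚ.∣ (+ U) ℚ./ suc N ℚ.- (+ 1) ℚ./ 6 ∣ ℚᵘ.≃ ℚᵘ.∣ w ∣
    ∣x-y∣≃∣w∣ = ℚᵘ.≃-trans (ℚ.toℚᵘ-homo-∣-∣ (x ℚ.- y)) (ℚᵘ.∣-∣-cong (ℚᵘ.≃-trans (ℚ.toℚᵘ-homo-+ x (ℚ.- y))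
      (ℚᵘ.≃-trans (ℚᵘ.+-cong (ℚ.toℚᵘ-fromℚᵘ (mkℚᵘ (+ U) N))
                            (ℚᵘ.≃-trans (ℚ.toℚᵘ-homo‿- y) (ℚᵘ.-‿cong (ℚ.toℚᵘ-fromℚᵘ (mkℚᵘ (+ 1) 5))))) x-y≃w)))
      where
      x y : ℚ
      x = (+ U) ℚ./ suc N
      y = (+ 1) ℚ./ 6
    ∣w∣<ε : ℚᵘ.∣ w ∣ ℚᵘ.< toℚᵘ ε
    ∣w∣<ε = ℚᵘ.*<* (subst₂ ℤ._<_ (ℤ.pos-* ℤ.∣ + (U * 6) ℤ.- + suc N ∣ (suc d-1)) (ℤ.pos-* (suc a) (suc N * 6))
      (+<+ (ℕ.<-≤-trans (subst (λ D → D * suc d-1 < suc N * 6) (sym (∣+m-+n∣ (U * 6) (suc N))) dev<6N)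
                        (ℕ.m≤n*m (suc N * 6) (suc a)))))
  close-to-a-sixth U N (mkℚ (+ zero) _ _) (*<* (+<+ ()))
  close-to-a-sixth U N (mkℚ -[1+ _ ] _ _) (*<* ())

module Density where

  open import Data.Nat as ℕ using (ℕ; zero; suc; _+_; _*_; _≤_; _<_; s≤s; _/_; ∣_-_∣)
  open import Data.Nat.Properties
  import Data.Nat.DivMod as ℕ
  open import Data.Nat.Solver using (module +-*-Solver)
  open import Data.Integer using (+_)
  open import Data.Rational as ℚ using (ℚ)
  open import Data.Product using (_,_)
  open import Function using (_∘_)
  open import Relation.Binary.PropositionalEquality
  open import Relation.Nullary using (¬_)
  open import Data.Empty using (⊥-elim)
  open import Defs using (ratio; countUpTo; inNsfᵇ; inUᵇ; Converges)
  open Counting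
  open Sieve using (module Residues)
  open Comparison
  open Limit
  open +-*-Solver using (solve; _:+_; _:*_; _:=_; con)

  -- Sieving up to K = 6k keeps the tail below X/(2k); together with N ≥ X/4 − 1 this leaves
  -- only the periodic error 7L, absorbed by X₀ = 7 + k(6 + 7L).
  small-deviation : ∀ {D N X} k L → D ≤ 6 * (1 + X / (2 + 2 * (6 * k))) + 7 * L → X ≤ 4 * N + 4 →
                    7 + k * (6 + 7 * L) ≤ X → D * k < N * 6
  small-deviation {D} {N} {X} k L D≤ X≤ X₀≤X = *-cancelˡ-< 2 (D * k) (N * 6) (+-cancelʳ-< 12 (2 * (D * k)) (2 * (N * 6)) (begin-strict
    2 * (D * k) + 12                                      ≤⟨ +-monoˡ-≤ 12 (*-monoʳ-≤ 2 (*-monoˡ-≤ k D≤)) ⟩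
    2 * ((6 * (1 + X / p) + 7 * L) * k) + 12              ≡⟨ solve 3 (λ q k L → con 2 :* ((con 6 :* (con 1 :+ q) :+ con 7 :* L) :* k) :+ con 12
                                                               := con 12 :* k :+ con 14 :* (k :* L) :+ con 12 :+ q :* (con 12 :* k)) refl (X / p) k L ⟩
    a′ + X / p * (12 * k)                                 ≤⟨ +-monoʳ-≤ a′ (≤-trans (*-monoʳ-≤ (X / p) 12k≤p) (ℕ.m/n*n≤m X p)) ⟩
    a′ + X                                                <⟨ +-monoˡ-< X a′<2X ⟩
    2 * X + X                                             ≡⟨ solve 1 (λ X → con 2 :* X :+ X := con 3 :* X) refl X ⟩
    3 * X                                                 ≤⟨ *-monoʳ-≤ 3 X≤ ⟩
    3 * (4 * N + 4)                                       ≡⟨ solve 1 (λ N → con 3 :* (con 4 :* N :+ con 4) := con 2 :* (N :* con 6) :+ con 12) refl N ⟩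
    2 * (N * 6) + 12                                      ∎))
    where
    open ≤-Reasoning
    p : ℕ
    p = 2 + 2 * (6 * k)
    a′ : ℕ
    a′ = 12 * k + 14 * (k * L) + 12
    12k≤p : 12 * k ≤ p
    12k≤p = subst (_≤ p) (sym (*-assoc 2 6 k)) (m≤n+m (2 * (6 * k)) 2)
    a′<2X : a′ < 2 * X
    a′<2X = ≤-trans (n≤1+n (suc a′)) (≤-trans (≤-reflexive 2+a′≡) (*-monoʳ-≤ 2 X₀≤X))
      where
      2+a′≡ : 2 + a′ ≡ 2 * (7 + k * (6 + 7 * L))
      2+a′≡ = solve 2 (λ k L → con 2 :+ (con 12 :* k :+ con 14 :* (k :* L) :+ con 12) := con 2 :* (con 7 :+ k :* (con 6 :+ con 7 :* L))) refl k L

  ratio-of-counts : ∀ X {n} → countUpTo inNsfᵇ X ≡ suc n → ratio X ≡ (+ countUpTo inUᵇ X) ℚ./ suc n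
  ratio-of-counts X N≡ with countUpTo inNsfᵇ X
  ratio-of-counts X refl | .(suc _) = refl

  density : Converges ratio ((+ 1) ℚ./ 6)
  density ε 0<ε = 7 + k * (6 + 7 * L) , λ X X₀≤X → at X X₀≤X (count (inNsfᵇ ∘ suc) X) refl
    where
    k K L : ℕ
    k = ℚ.↧ₙ ε
    K = 6 * k
    L = Residues.L K
    at : ∀ X → 7 + k * (6 + 7 * L) ≤ X → ∀ N → count (inNsfᵇ ∘ suc) X ≡ N → ℚ.∣ ratio X ℚ.- (+ 1) ℚ./ 6 ∣ ℚ.< ε
    at X X₀≤X zero N≡0 = ⊥-elim (7≰4 (≤-trans (≤-trans (m≤m+n 7 _) X₀≤X) (subst (λ N → X ≤ 4 * N + 4) N≡0 (squareFree-lower-bound X))))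
      where
      7≰4 : ¬ (7 ≤ 4)
      7≰4 (s≤s (s≤s (s≤s (s≤s ()))))
    at X X₀≤X (suc n) N≡ = subst (λ r → ℚ.∣ r ℚ.- (+ 1) ℚ./ 6 ∣ ℚ.< ε) (sym (trans (ratio-of-counts X (trans (countUpTo≡count inNsfᵇ X) N≡))
                                                                         (cong (λ u → (+ u) ℚ./ suc n) (countUpTo≡count inUᵇ X))))
      (close-to-a-sixth (count (inUᵇ ∘ suc) X) n ε 0<ε
        (small-deviation k L (subst (λ N → ∣ count (inUᵇ ∘ suc) X * 6 - N ∣ ≤ 6 * (1 + X / (2 + 2 * K)) + 7 * L) N≡ (Deviation.deviation K X))
                             (subst (λ N → X ≤ 4 * N + 4) N≡ (squareFree-lower-bound X)) X₀≤X))

open import Defs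
open import Data.Nat using (ℕ; _≤_)
open import Data.Integer using (+_)
open import Data.Rational using (_/_)
open import Data.Product using (_×_; ∃-syntax; _,_)
open import Relation.Nullary using (¬_)
open import Relation.Binary.PropositionalEquality using (_≢_; _≡_)

theorem2p5 : Converges ratio ((+ 1) / 6)
    × (∀ (t : ℕ) → InU t →
        ∀ (a b : K) → IsIntegral t a → IsIntegral t b → a ≢ 0K t → b ≢ 0K t →
        ∀ (r d : ℕ) → 1 ≤ r → 2 ≤ d → Odd r →
        ¬ (∃[ x ] ∃[ y ] ∃[ z ] (IsIntegral t x × IsIntegral t y × IsIntegral t z × In2OK t x
            × lhs t a b d r x y z ≡ 0K t)))
theorem2p5 = Density.density , λ t (_ , _ , t%8≡1) a b a-int b-int _ _ r d _ 2≤d r-odd →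
  IntegralityAtTwo.no-solution t t%8≡1 a b a-int b-int r d 2≤d r-odd
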